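{- Let $n_1,\dots,n_k$ be positive integers, $L=\operatorname{lcm}(n_1,\dots,n_k)$, $A=\prod_{j=1}^k\mathbb{Z}/n_j\mathbb{Z}$, and $w\in\mathbb{N}$ a positive integer. For each prime $p$ let $h_p:=\max\{\operatorname{ord}_p(n_j): 1\le j\le k\}$ and for $1\le i\le h_p$ let $m_{p,i}:=\#\{j\in\{1,\dots,k\}:\operatorname{ord}_p(n_j)=i\}$, so that $A\cong\prod_p\prod_{i=1}^{h_p}(\mathbb{Z}/p^i\mathbb{Z})^{m_{p,i}}$. Then $$\frac1L\sum_{l=1}^{L}\bigl(\gcd(l,n_1)\cdots\gcd(l,n_k)\bigr)^w=\prod_p\mu\Bigl(\prod_{i=1}^{h_p}(\mathbb{Z}/p^i\mathbb{Z})^{w m_{p,i}}\Bigr)$$ $$=\prod_p\left(1+\sum_{l=1}^{h_p}\Bigl(p^{w\sum_{i=l}^{h_p}m_{p,i}}-1\Bigr)p^{w\left(\sum_{i=1}^{l-1}i\,m_{p,i}+(l-1)\sum_{i=l}^{h_p}m_{p,i}\right)}\frac{1}{p^l}\right)=\prod_p\left(1+\sum_{l=1}^{h_p}\Bigl(p^{w\sum_{i=l}^{h_p}m_{p,i}}-1\Bigr)p^{w\left(\sum_{i=1}^{l-1}i\,m_{p,i}+(l-1)\sum_{i=l}^{h_p}m_{p,i}\right)-l}\right),$$ where the products run over all primes $p$ (all but finitely many factors equal $1$, namely those with $h_p=0$).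
   Context: For a finite abelian group $B$, $\mu(B):=\sum_{b\in B}\frac{1}{|b|}$, where $|b|$ is the order of $b$. $\operatorname{ord}_p(n)$ is the exponent of the prime $p$ in $n$. Empty sums are $0$. -}

module Defs where

open import Data.Nat as ℕ using (ℕ; zero; suc; _⊔_; _≟_; _≤ᵇ_)
open import Data.Nat.Divisibility using (_∣?_)
open import Data.Nat.Primality using (prime?)
open import Data.Nat.GCD using (gcd)
open import Data.Nat.LCM using (lcm)
open import Data.Integer as ℤ using (ℤ; +_; -[1+_])
open import Data.Rational as ℚ using (ℚ; 0ℚ; 1ℚ)
open import Data.Fin using (Fin)
open import Data.List using (List; []; _∷_; map; foldr; concat; concatMap; replicate; filter; length; upTo; applyUpTo; all)
open import Data.List.Base using (allFin)
open import Data.Bool using (Bool; true; false; if_then_else_; _∧_)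
open import Relation.Nullary using (does)

-- [a .. b] (empty if b < a)
range : ℕ → ℕ → List ℕ
range a b = applyUpTo (λ i → a ℕ.+ i) (suc b ℕ.∸ a)

sumℕ : List ℕ → ℕ
sumℕ = foldr ℕ._+_ 0

prodℕ : List ℕ → ℕ
prodℕ = foldr ℕ._*_ 1

sumℚ : List ℚ → ℚ
sumℚ = foldr ℚ._+_ 0ℚ

prodℚ : List ℚ → ℚ
prodℚ = foldr ℚ._*_ 1ℚ

ℕ→ℚ : ℕ → ℚ
ℕ→ℚ n = + n ℚ./ 1

-- 1/n for a natural number n (only used for n ≥ 1; 1/0 := 0)
recipℕ : ℕ → ℚ
recipℕ zero    = 0ℚ
recipℕ (suc n) = + 1 ℚ./ suc n

-- p^e for p : ℕ and an integer exponent e (p ≥ 1 in all uses)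
powℤ : ℕ → ℤ → ℚ
powℤ p (+ n)     = ℕ→ℚ (p ℕ.^ n)
powℤ p -[1+ n ]  = recipℕ (p ℕ.^ suc n)

-- p-adic valuation ord_p(n): the exponent of p in n (0 if n = 0 or p < 2)

ordAux : ℕ → ℕ → ℕ → ℕ
ordAux zero    p m = 0
ordAux (suc f) zero m = 0
ordAux (suc f) (suc zero) m = 0
ordAux (suc f) p@(suc (suc _)) zero = 0
ordAux (suc f) p@(suc (suc _)) m@(suc _) with does (p ∣? m)
... | true  = suc (ordAux f p (m ℕ./ p))
... | false = 0

ord : ℕ → ℕ → ℕ
ord p n = ordAux n p n

-- Finite abelian groups of the form ∏_j ℤ/m_jℤ, given by the list of
-- moduli (m_j).  Elements are lists (x_j) with 0 ≤ x_j < m_j.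

elems : List ℕ → List (List ℕ)
elems []       = [] ∷ []
elems (m ∷ ms) = concatMap (λ x → map (x ∷_) (elems ms)) (upTo m)

killsᵇ : ℕ → List ℕ → List ℕ → Bool
killsᵇ t []       _        = true
killsᵇ t (m ∷ ms) []       = true
killsᵇ t (m ∷ ms) (x ∷ xs) = does (m ∣? (t ℕ.* x)) ∧ killsᵇ t ms xs

-- least t ∈ {s, s+1, ..., s+f-1} with t·x = 0; default s+f
searchFrom : ℕ → ℕ → List ℕ → List ℕ → ℕ
searchFrom s zero    ms x = s
searchFrom s (suc f) ms x = if killsᵇ s ms x then s else searchFrom (suc s) f ms x

-- order |x| of x: least t ≥ 1 with t·x = 0.  By Lagrange |x| ≤ |B| = ∏ m_j,
-- so searching t ∈ {1, ..., ∏ m_j} finds it.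
order : List ℕ → List ℕ → ℕ
order ms x = searchFrom 1 (prodℕ ms) ms x

μ : List ℕ → ℚ
μ ms = sumℚ (map (λ x → recipℕ (order ms x)) (elems ms))

module _ (k : ℕ) (n : Fin k → ℕ) where

  lcmAll : ℕ
  lcmAll = foldr lcm 1 (map n (allFin k))

  h : ℕ → ℕ
  h p = foldr _⊔_ 0 (map (λ j → ord p (n j)) (allFin k))

  mult : ℕ → ℕ → ℕ
  mult p i = length (filter (λ j → ord p (n j) ≟ i) (allFin k))

  -- primes p ≤ L (every prime with h_p > 0 divides L, hence is ≤ L;
  -- the remaining factors of the product over all primes are 1)
  primesUpToL : List ℕ
  primesUpToL = filter prime? (range 0 lcmAll)

  average : ℕ → ℚ
  average w = recipℕ lcmAll ℚ.* ℕ→ℚ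
    (sumℕ (map (λ l → prodℕ (map (λ j → gcd l (n j)) (allFin k)) ℕ.^ w) (range 1 lcmAll)))

  localModuli : ℕ → ℕ → List ℕ
  localModuli w p = concatMap (λ i → replicate (w ℕ.* mult p i) (p ℕ.^ i)) (range 1 (h p))

  muProduct : ℕ → ℚ
  muProduct w = prodℚ (map (λ p → μ (localModuli w p)) primesUpToL)

  tailSum : ℕ → ℕ → ℕ
  tailSum p l = sumℕ (map (mult p) (range l (h p)))

  expo : ℕ → ℕ → ℕ → ℕ
  expo w p l = w ℕ.* (sumℕ (map (λ i → i ℕ.* mult p i) (range 1 (l ℕ.∸ 1)))
                      ℕ.+ (l ℕ.∸ 1) ℕ.* tailSum p l)

  localFormula₁ : ℕ → ℕ → ℚ
  localFormula₁ w p = 1ℚ ℚ.+ sumℚ (map (λ l →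
      (ℕ→ℚ (p ℕ.^ (w ℕ.* tailSum p l)) ℚ.- 1ℚ) ℚ.* ℕ→ℚ (p ℕ.^ expo w p l)
        ℚ.* recipℕ (p ℕ.^ l)) (range 1 (h p)))

  localFormula₂ : ℕ → ℕ → ℚ
  localFormula₂ w p = 1ℚ ℚ.+ sumℚ (map (λ l →
      (ℕ→ℚ (p ℕ.^ (w ℕ.* tailSum p l)) ℚ.- 1ℚ) ℚ.* powℤ p (+ expo w p l ℤ.- + l))
      (range 1 (h p)))

  formulaProduct₁ : ℕ → ℚ
  formulaProduct₁ w = prodℚ (map (localFormula₁ w) primesUpToL)

  formulaProduct₂ : ℕ → ℚ
  formulaProduct₂ w = prodℚ (map (localFormula₂ w) primesUpToL)

{-# OPTIONS --safe #-}
-- If M is a common multiple of the moduli of B = ∏_j ℤ/m_jℤ, every order |x| divides M and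
-- 1/|x| = #{t < M : t x = 0} / M.  Since t x = 0 has ∏_j gcd(t, m_j) solutions x, this gives
-- μ(B) = (1/M) Σ_{t<M} ∏_j gcd(t, m_j), an average of a product of gcds, like the left-hand side.
-- Both averages factor over primes: gcd(l, n) = ∏_p gcd(l, p^{ord_p n}), and by the Chinese
-- remainder theorem an average over l < ∏_p p^{h_p} of a product of p^{h_p}-periodic functions is
-- the product of the averages over l < p^{h_p}.  At a prime p, ∏_i gcd(t, p^i)^{w m_{p,i}} equals
-- p^{w Σ_i min(ord_p t, i) m_{p,i}}; it grows by the l-th term of the closed formula (times p^l)
-- when ord_p t passes from l - 1 to l, and p^{h_p - l} of the t ≤ p^{h_p} have ord_p t ≥ l.
-- The argument does not use w ≥ 1.
module Submission where

open import Defs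
open import Data.Nat using (ℕ; zero; suc; _+_; _*_; _∸_; _^_; _≤_; _<_; z≤n; s≤s; z<s; NonZero; >-nonZero; >-nonZero⁻¹; ≢-nonZero; ≢-nonZero⁻¹; nonTrivial⇒n>1; _⊓_; _⊔_; _≟_; _<ᵇ_)
open import Data.Nat.Properties
open import Data.Nat.Divisibility
open import Data.Nat.DivMod
open import Data.Nat.GCD
open import Data.Nat.LCM
open import Data.Nat.Coprimality using (Coprime; coprime-divisor; coprime-/gcd; coprime⇒gcd≡1) renaming (sym to coprime-sym)
open import Data.Nat.Primality
open import Data.Nat.Primality.Factorisation using (factorise)
open import Data.Nat.ListAction using (product)
open import Data.Nat.ListAction.Properties using (sum-++; product-++; ∈⇒∣product; product≢0)
open import Data.Nat.Induction using (<-rec)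
open import Data.List using (List; []; _∷_; map; foldr; concatMap; replicate; filter; length; upTo; applyUpTo)
open import Data.List.Base using (allFin)
open import Data.List.Properties using (map-++; map-cong; map-cong-local; map-∘)
open import Data.List.Relation.Unary.All as All using (All; []; _∷_)
open import Data.List.Relation.Unary.All.Properties using (concat⁺; replicate⁺; applyUpTo⁺₁; applyUpTo⁺₂; map⁺; map⁻; all-filter)
open import Data.List.Relation.Unary.Any using (here; there)
open import Data.List.Relation.Unary.Unique.Propositional using (Unique)
open import Data.List.Relation.Unary.AllPairs using ([]; _∷_)
import Data.List.Relation.Unary.Unique.Propositional.Properties as Uniqueₚ
open import Data.List.Membership.Propositional using (_∈_)
open import Data.List.Membership.Propositional.Properties using (∈-filter⁺; ∈-applyUpTo⁺; ∈-map⁺; ∈-allFin)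
open import Data.Fin using (Fin)
open import Data.Bool using (Bool; true; false; _∧_; T)
import Data.Bool.Properties as Bool
open import Function.Bundles using (Equivalence)
open import Data.Product using (∃; _×_; _,_; proj₁; proj₂)
open import Data.Sum using (inj₁; inj₂)
open import Data.Unit using (⊤; tt)
open import Relation.Nullary using (¬_; Dec; yes; no; does; proof; contradiction)
open import Relation.Nullary.Reflects using (Reflects; ofʸ; ofⁿ; _×-reflects_)
open import Relation.Nullary.Decidable using (dec-true; dec-false)
open import Relation.Binary.PropositionalEquality using (_≡_; _≢_; refl; sym; trans; cong; cong₂; subst; subst₂; module ≡-Reasoning)
import Data.Rational as ℚ
import Data.Rational.Properties as ℚP
import Data.Rational.Unnormalised as U
import Data.Rational.Unnormalised.Properties as UP
import Data.Integer as ℤ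
import Data.Integer.Properties as ℤP
open import Algebra.Bundles using (CommutativeMonoid)
import Data.Nat.Solver as ℕSolver
open import Algebra.Properties.CommutativeSemigroup +-commutativeSemigroup using () renaming (interchange to +-interchange)
open import Algebra.Properties.CommutativeSemigroup *-commutativeSemigroup using () renaming (interchange to *-interchange; x∙yz≈y∙xz to x*[y*z]≡y*[x*z])
open import Algebra.Properties.CommutativeSemigroup (CommutativeMonoid.commutativeSemigroup ℚP.*-1-commutativeMonoid) using () renaming (interchange to ℚ*-interchange; x∙yz≈zy∙x to x*[y*z]≡[z*y]*x)

^-split : ∀ p {a b} → a ≤ b → p ^ b ≡ p ^ a * p ^ (b ∸ a)
^-split p {a} {b} a≤b = trans (cong (p ^_) (sym (m+[n∸m]≡n a≤b))) (^-distribˡ-+-* p a (b ∸ a))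

^-monoʳ-∣ : ∀ p {a b} → a ≤ b → p ^ a ∣ p ^ b
^-monoʳ-∣ p {a} {b} a≤b = divides (p ^ (b ∸ a)) (trans (^-split p a≤b) (*-comm (p ^ a) _))

^-distribʳ-* : ∀ a b w → (a * b) ^ w ≡ a ^ w * b ^ w
^-distribʳ-* a b zero    = refl
^-distribʳ-* a b (suc w) = trans (cong (a * b *_) (^-distribʳ-* a b w)) (*-interchange a b (a ^ w) (b ^ w))

fromℚᵘ-* : ∀ x y → ℚ.fromℚᵘ (x U.* y) ≡ ℚ.fromℚᵘ x ℚ.* ℚ.fromℚᵘ y
fromℚᵘ-* x y = ℚP.toℚᵘ-injective (UP.≃-trans (ℚP.toℚᵘ-fromℚᵘ (x U.* y))
  (UP.≃-sym (UP.≃-trans (ℚP.toℚᵘ-homo-* (ℚ.fromℚᵘ x) (ℚ.fromℚᵘ y))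
     (UP.*-cong (ℚP.toℚᵘ-fromℚᵘ x) (ℚP.toℚᵘ-fromℚᵘ y)))))

fromℚᵘ-+ : ∀ x y → ℚ.fromℚᵘ (x U.+ y) ≡ ℚ.fromℚᵘ x ℚ.+ ℚ.fromℚᵘ y
fromℚᵘ-+ x y = ℚP.toℚᵘ-injective (UP.≃-trans (ℚP.toℚᵘ-fromℚᵘ (x U.+ y))
  (UP.≃-sym (UP.≃-trans (ℚP.toℚᵘ-homo-+ (ℚ.fromℚᵘ x) (ℚ.fromℚᵘ y))
     (UP.+-cong (ℚP.toℚᵘ-fromℚᵘ x) (ℚP.toℚᵘ-fromℚᵘ y)))))

ℕ→ℚ-* : ∀ a b → ℕ→ℚ (a * b) ≡ ℕ→ℚ a ℚ.* ℕ→ℚ b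
ℕ→ℚ-* a b = trans (cong (λ z → ℚ.fromℚᵘ (U.mkℚᵘ z 0)) (ℤP.pos-* a b))
  (fromℚᵘ-* (U.mkℚᵘ (ℤ.+ a) 0) (U.mkℚᵘ (ℤ.+ b) 0))

ℕ→ℚ-+ : ∀ a b → ℕ→ℚ (a + b) ≡ ℕ→ℚ a ℚ.+ ℕ→ℚ b
ℕ→ℚ-+ a b = trans (cong (λ z → ℚ.fromℚᵘ (U.mkℚᵘ z 0)) numerator)
  (fromℚᵘ-+ (U.mkℚᵘ (ℤ.+ a) 0) (U.mkℚᵘ (ℤ.+ b) 0))
  where
  numerator : ℤ.+ (a + b) ≡ ℤ.+ a ℤ.* ℤ.+ 1 ℤ.+ ℤ.+ b ℤ.* ℤ.+ 1
  numerator = trans (ℤP.pos-+ a b) (sym (cong₂ ℤ._+_ (ℤP.*-identityʳ (ℤ.+ a)) (ℤP.*-identityʳ (ℤ.+ b))))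

ℕ→ℚ-pred : ∀ x → 1 ≤ x → ℕ→ℚ (x ∸ 1) ≡ ℕ→ℚ x ℚ.- ℚ.1ℚ
ℕ→ℚ-pred (suc x) _ = sym (begin
    ℕ→ℚ (suc x) ℚ.- ℚ.1ℚ              ≡⟨ cong (ℚ._- ℚ.1ℚ) (trans (cong ℕ→ℚ (+-comm 1 x)) (ℕ→ℚ-+ x 1)) ⟩
    ℕ→ℚ x ℚ.+ ℚ.1ℚ ℚ.- ℚ.1ℚ           ≡⟨ ℚP.+-assoc (ℕ→ℚ x) ℚ.1ℚ (ℚ.- ℚ.1ℚ) ⟩
    ℕ→ℚ x ℚ.+ (ℚ.1ℚ ℚ.- ℚ.1ℚ)         ≡⟨ cong (ℕ→ℚ x ℚ.+_) (ℚP.+-inverseʳ ℚ.1ℚ) ⟩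
    ℕ→ℚ x ℚ.+ ℚ.0ℚ                    ≡⟨ ℚP.+-identityʳ (ℕ→ℚ x) ⟩
    ℕ→ℚ x ∎)
  where open ≡-Reasoning

recipℕ-* : ∀ a b → .{{NonZero a}} → .{{NonZero b}} → recipℕ (a * b) ≡ recipℕ a ℚ.* recipℕ b
recipℕ-* (suc a) (suc b) = fromℚᵘ-* (U.mkℚᵘ (ℤ.+ 1) a) (U.mkℚᵘ (ℤ.+ 1) b)

sumℚ-ℕ→ℚ : ∀ {A : Set} (f : A → ℕ) xs → sumℚ (map (λ x → ℕ→ℚ (f x)) xs) ≡ ℕ→ℚ (sumℕ (map f xs))
sumℚ-ℕ→ℚ f [] = refl
sumℚ-ℕ→ℚ f (x ∷ xs) = trans (cong (ℕ→ℚ (f x) ℚ.+_) (sumℚ-ℕ→ℚ f xs)) (sym (ℕ→ℚ-+ (f x) _))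

sumℚ-*ˡ : ∀ {A : Set} c (f : A → ℚ.ℚ) xs → sumℚ (map (λ x → c ℚ.* f x) xs) ≡ c ℚ.* sumℚ (map f xs)
sumℚ-*ˡ c f [] = sym (ℚP.*-zeroʳ c)
sumℚ-*ˡ c f (x ∷ xs) = trans (cong (c ℚ.* f x ℚ.+_) (sumℚ-*ˡ c f xs)) (sym (ℚP.*-distribˡ-+ c (f x) _))

ratio : ℕ → ℕ → ℚ.ℚ
ratio a b = recipℕ b ℚ.* ℕ→ℚ a

ratio-self : ∀ a → .{{NonZero a}} → ratio a a ≡ ℚ.1ℚ
ratio-self (suc a) = trans (sym (fromℚᵘ-* (U.mkℚᵘ (ℤ.+ 1) a) (U.mkℚᵘ (ℤ.+ suc a) 0)))
  (ℚP.fromℚᵘ-cong {U.mkℚᵘ (ℤ.+ 1 ℤ.* ℤ.+ suc a) (suc a * 1 ∸ 1)} {U.mkℚᵘ (ℤ.+ 1) 0} (U.*≡* cross))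
  where
  cross : (ℤ.+ 1 ℤ.* ℤ.+ suc a) ℤ.* ℤ.+ 1 ≡ ℤ.+ 1 ℤ.* ℤ.+ (suc a * 1)
  cross = cong (λ z → ℤ.+ z) (trans (*-identityʳ (1 * suc a)) (cong (1 *_) (sym (*-identityʳ (suc a)))))

ratio-* : ∀ a b x y → .{{NonZero a}} → .{{NonZero b}} → ratio (x * y) (a * b) ≡ ratio x a ℚ.* ratio y b
ratio-* a b x y = begin
  recipℕ (a * b) ℚ.* ℕ→ℚ (x * y)                       ≡⟨ cong₂ ℚ._*_ (recipℕ-* a b) (ℕ→ℚ-* x y) ⟩
  (recipℕ a ℚ.* recipℕ b) ℚ.* (ℕ→ℚ x ℚ.* ℕ→ℚ y)        ≡⟨ ℚ*-interchange (recipℕ a) (recipℕ b) (ℕ→ℚ x) (ℕ→ℚ y) ⟩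
  (recipℕ a ℚ.* ℕ→ℚ x) ℚ.* (recipℕ b ℚ.* ℕ→ℚ y)        ∎
  where open ≡-Reasoning

ratio-cancelˡ : ∀ a b x → .{{NonZero a}} → .{{NonZero b}} → ratio (a * x) (a * b) ≡ ratio x b
ratio-cancelˡ a b x = trans (ratio-* a b a x) (trans (cong (ℚ._* ratio x b) (ratio-self a)) (ℚP.*-identityˡ (ratio x b)))

ratio-cross : ∀ a b L M → .{{NonZero L}} → .{{NonZero M}} → M * a ≡ L * b → ratio a L ≡ ratio b M
ratio-cross a b L M eq = begin
  ratio a L                ≡⟨ sym (ratio-cancelˡ M L a) ⟩
  ratio (M * a) (M * L)    ≡⟨ cong₂ ratio eq (*-comm M L) ⟩
  ratio (L * b) (L * M)    ≡⟨ ratio-cancelˡ L M b ⟩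
  ratio b M                ∎
  where open ≡-Reasoning

prodℚ-ratio : ∀ {A : Set} (num den : A → ℕ) xs → All (λ x → NonZero (den x)) xs →
  ratio (prodℕ (map num xs)) (prodℕ (map den xs)) ≡ prodℚ (map (λ x → ratio (num x) (den x)) xs)
prodℚ-ratio num den [] [] = refl
prodℚ-ratio num den (x ∷ xs) (nz ∷ nzs) = trans
  (ratio-* (den x) (prodℕ (map den xs)) (num x) _ {{nz}} {{product≢0 (map⁺ nzs)}})
  (cong (ratio (num x) (den x) ℚ.*_) (prodℚ-ratio num den xs nzs))

ratio-+ : ∀ a b M → ratio (a + b) M ≡ ratio a M ℚ.+ ratio b M
ratio-+ a b M = trans (cong (recipℕ M ℚ.*_) (ℕ→ℚ-+ a b)) (ℚP.*-distribˡ-+ (recipℕ M) (ℕ→ℚ a) (ℕ→ℚ b))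

ratio-sum : ∀ {A : Set} (f : A → ℕ) M xs → ratio (sumℕ (map f xs)) M ≡ sumℚ (map (λ x → ratio (f x) M) xs)
ratio-sum f M xs = sym (trans (sumℚ-*ˡ (recipℕ M) (λ x → ℕ→ℚ (f x)) xs) (cong (recipℕ M ℚ.*_) (sumℚ-ℕ→ℚ f xs)))

ratio-denominator-1 : ∀ x → ratio x 1 ≡ ℕ→ℚ x
ratio-denominator-1 x = ℚP.*-identityˡ (ℕ→ℚ x)

powℤ-neg : ∀ p d → powℤ p (ℤ.- ℤ.+ d) ≡ recipℕ (p ^ d)
powℤ-neg p zero    = refl
powℤ-neg p (suc d) = refl

ℕ→ℚ-^-*-recipℕ-^ : ∀ p E l → .{{NonZero p}} → ℕ→ℚ (p ^ E) ℚ.* recipℕ (p ^ l) ≡ powℤ p (ℤ.+ E ℤ.- ℤ.+ l)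
ℕ→ℚ-^-*-recipℕ-^ p E l with ≤-total l E
... | inj₁ l≤E = begin
  ℕ→ℚ (p ^ E) ℚ.* recipℕ (p ^ l)     ≡⟨ ℚP.*-comm (ℕ→ℚ (p ^ E)) (recipℕ (p ^ l)) ⟩
  ratio (p ^ E) (p ^ l)              ≡⟨ cong₂ ratio (^-split p l≤E) (sym (*-identityʳ (p ^ l))) ⟩
  ratio (p ^ l * p ^ d) (p ^ l * 1)  ≡⟨ ratio-cancelˡ (p ^ l) 1 (p ^ d) {{m^n≢0 p l}} ⟩
  ratio (p ^ d) 1                    ≡⟨ ratio-denominator-1 (p ^ d) ⟩
  powℤ p (ℤ.+ d)                     ≡⟨ cong (powℤ p) (sym (trans (ℤP.m-n≡m⊖n E l) (ℤP.⊖-≥ l≤E))) ⟩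
  powℤ p (ℤ.+ E ℤ.- ℤ.+ l)           ∎
  where
  open ≡-Reasoning
  d : ℕ
  d = E ∸ l
... | inj₂ E≤l = begin
  ℕ→ℚ (p ^ E) ℚ.* recipℕ (p ^ l)     ≡⟨ ℚP.*-comm (ℕ→ℚ (p ^ E)) (recipℕ (p ^ l)) ⟩
  ratio (p ^ E) (p ^ l)              ≡⟨ cong₂ ratio (sym (*-identityʳ (p ^ E))) (^-split p E≤l) ⟩
  ratio (p ^ E * 1) (p ^ E * p ^ d)  ≡⟨ ratio-cancelˡ (p ^ E) (p ^ d) 1 {{m^n≢0 p E}} {{m^n≢0 p d}} ⟩
  recipℕ (p ^ d) ℚ.* ℚ.1ℚ            ≡⟨ ℚP.*-identityʳ (recipℕ (p ^ d)) ⟩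
  recipℕ (p ^ d)                     ≡⟨ sym (powℤ-neg p d) ⟩
  powℤ p (ℤ.- ℤ.+ d)                 ≡⟨ cong (powℤ p) (sym (trans (ℤP.m-n≡m⊖n E l) (ℤP.⊖-≤ E≤l))) ⟩
  powℤ p (ℤ.+ E ℤ.- ℤ.+ l)           ∎
  where
  open ≡-Reasoning
  d : ℕ
  d = l ∸ E

Σ< : ℕ → (ℕ → ℕ) → ℕ
Σ< zero    f = 0
Σ< (suc n) f = f 0 + Σ< n (λ i → f (suc i))

Π< : ℕ → (ℕ → ℕ) → ℕ
Π< zero    f = 1
Π< (suc n) f = f 0 * Π< n (λ i → f (suc i))

Σ<-cong-< : ∀ n {f g : ℕ → ℕ} → (∀ i → i < n → f i ≡ g i) → Σ< n f ≡ Σ< n g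
Σ<-cong-< zero    eq = refl
Σ<-cong-< (suc n) eq = cong₂ _+_ (eq 0 z<s) (Σ<-cong-< n (λ i i<n → eq (suc i) (s≤s i<n)))

Σ<-cong : ∀ n {f g : ℕ → ℕ} → (∀ i → f i ≡ g i) → Σ< n f ≡ Σ< n g
Σ<-cong n eq = Σ<-cong-< n (λ i _ → eq i)

Π<-cong-< : ∀ n {f g : ℕ → ℕ} → (∀ i → i < n → f i ≡ g i) → Π< n f ≡ Π< n g
Π<-cong-< zero    eq = refl
Π<-cong-< (suc n) eq = cong₂ _*_ (eq 0 z<s) (Π<-cong-< n (λ i i<n → eq (suc i) (s≤s i<n)))

Σ<-split : ∀ m n f → Σ< (m + n) f ≡ Σ< m f + Σ< n (λ i → f (m + i))
Σ<-split zero    n f = refl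
Σ<-split (suc m) n f = trans (cong (f 0 +_) (Σ<-split m n (λ i → f (suc i)))) (sym (+-assoc (f 0) _ _))

Σ<-snoc : ∀ n f → Σ< (suc n) f ≡ Σ< n f + f n
Σ<-snoc n f = begin
  Σ< (suc n) f                       ≡⟨ cong (λ m → Σ< m f) (+-comm 1 n) ⟩
  Σ< (n + 1) f                       ≡⟨ Σ<-split n 1 f ⟩
  Σ< n f + (f (n + 0) + 0)           ≡⟨ cong (λ x → Σ< n f + x) (trans (+-identityʳ _) (cong f (+-identityʳ n))) ⟩
  Σ< n f + f n                       ∎
  where open ≡-Reasoning

Σ<-distrib-+ : ∀ n f g → Σ< n (λ i → f i + g i) ≡ Σ< n f + Σ< n g
Σ<-distrib-+ zero    f g = refl
Σ<-distrib-+ (suc n) f g = trans (cong ((f 0 + g 0) +_) (Σ<-distrib-+ n (λ i → f (suc i)) (λ i → g (suc i))))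
  (+-interchange (f 0) (g 0) _ _)

Σ<-*ˡ : ∀ n c f → Σ< n (λ i → c * f i) ≡ c * Σ< n f
Σ<-*ˡ zero    c f = sym (*-zeroʳ c)
Σ<-*ˡ (suc n) c f = trans (cong (c * f 0 +_) (Σ<-*ˡ n c (λ i → f (suc i)))) (sym (*-distribˡ-+ c (f 0) _))

Σ<-*ʳ : ∀ n c f → Σ< n (λ i → f i * c) ≡ Σ< n f * c
Σ<-*ʳ n c f = trans (Σ<-cong n (λ i → *-comm (f i) c)) (trans (Σ<-*ˡ n c f) (*-comm c _))

Σ<-const : ∀ n c → Σ< n (λ _ → c) ≡ n * c
Σ<-const zero    c = refl
Σ<-const (suc n) c = cong (c +_) (Σ<-const n c)

Σ<-zero : ∀ n f → (∀ i → i < n → f i ≡ 0) → Σ< n f ≡ 0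
Σ<-zero n f eq = trans (Σ<-cong-< n eq) (trans (Σ<-const n 0) (*-zeroʳ n))

Σ<-swap : ∀ m n (f : ℕ → ℕ → ℕ) → Σ< m (λ i → Σ< n (f i)) ≡ Σ< n (λ j → Σ< m (λ i → f i j))
Σ<-swap zero    n f = sym (Σ<-zero n _ (λ _ _ → refl))
Σ<-swap (suc m) n f = trans (cong (Σ< n (f 0) +_) (Σ<-swap m n (λ i → f (suc i))))
  (sym (Σ<-distrib-+ n (f 0) (λ j → Σ< m (λ i → f (suc i) j))))

Σ<-≤ : ∀ n c f → (∀ i → i < n → f i ≤ c) → Σ< n f ≤ n * c
Σ<-≤ zero    c f le = z≤n
Σ<-≤ (suc n) c f le = +-mono-≤ (le 0 z<s) (Σ<-≤ n c (λ i → f (suc i)) (λ i i<n → le (suc i) (s≤s i<n)))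

Σ<-≤-tight : ∀ n c f → (∀ i → i < n → f i ≤ c) → Σ< n f ≡ n * c → ∀ i → i < n → f i ≡ c
Σ<-≤-tight (suc n) c f le eq = tight
  where
  le-tail : ∀ i → i < n → f (suc i) ≤ c
  le-tail i i<n = le (suc i) (s≤s i<n)
  head : f 0 ≡ c
  head = ≤-antisym (le 0 z<s)
    (≮⇒≥ (λ f0<c → <⇒≢ (+-mono-<-≤ f0<c (Σ<-≤ n c (λ i → f (suc i)) le-tail)) eq))
  tail : Σ< n (λ i → f (suc i)) ≡ n * c
  tail = +-cancelˡ-≡ c _ _ (trans (cong (_+ Σ< n (λ i → f (suc i))) (sym head)) eq)
  tight : ∀ i → i < suc n → f i ≡ c
  tight zero    _         = head
  tight (suc i) (s≤s i<n) = Σ<-≤-tight n c (λ i → f (suc i)) le-tail tail i i<n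

Periodic : ℕ → (ℕ → ℕ) → Set
Periodic A f = ∀ x → f (x + A) ≡ f x

Σ<-periodic : ∀ P c f → Periodic P f → Σ< (c * P) f ≡ c * Σ< P f
Σ<-periodic P zero    f per = refl
Σ<-periodic P (suc c) f per = trans (Σ<-split P (c * P) f)
  (cong (Σ< P f +_) (trans (Σ<-cong (c * P) (λ i → trans (cong f (+-comm P i)) (per i))) (Σ<-periodic P c f per)))

Σ<-rotate : ∀ n f → f 0 ≡ f n → Σ< n (λ i → f (suc i)) ≡ Σ< n f
Σ<-rotate n f eq = +-cancelʳ-≡ (f n) _ _
  (trans (+-comm _ (f n)) (trans (cong (_+ Σ< n (λ i → f (suc i))) (sym eq)) (Σ<-snoc n f)))

𝟙 : Bool → ℕ
𝟙 true  = 1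
𝟙 false = 0

𝟙-∧ : ∀ a b → 𝟙 (a ∧ b) ≡ 𝟙 a * 𝟙 b
𝟙-∧ true  b = sym (+-identityʳ (𝟙 b))
𝟙-∧ false b = refl

δ : ℕ → ℕ → ℕ
δ x a = 𝟙 (does (x ≟ a))

reflects-⇔ : ∀ {A B : Set} {a b} → Reflects A a → Reflects B b → (A → B) → (B → A) → a ≡ b
reflects-⇔ (ofʸ _)  (ofʸ _)  _   _   = refl
reflects-⇔ (ofʸ x)  (ofⁿ ¬y) A→B _   = contradiction (A→B x) ¬y
reflects-⇔ (ofⁿ ¬x) (ofʸ y)  _   B→A = contradiction (B→A y) ¬x
reflects-⇔ (ofⁿ _)  (ofⁿ _)  _   _   = refl

Σ<-δ : ∀ A x f → x < A → Σ< A (λ a → δ x a * f a) ≡ f x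
Σ<-δ (suc A) zero    f _         = trans (cong (f 0 + 0 +_) (Σ<-zero A _ (λ _ _ → refl)))
                                          (trans (+-identityʳ _) (+-identityʳ _))
Σ<-δ (suc A) (suc x) f (s≤s x<A) = Σ<-δ A x (λ i → f (suc i)) x<A

Σ<-δ-1 : ∀ n x → x < n → Σ< n (δ x) ≡ 1
Σ<-δ-1 n x x<n = trans (Σ<-cong n (λ a → sym (*-identityʳ (δ x a)))) (Σ<-δ n x (λ _ → 1) x<n)

Σ<-𝟙-unique : ∀ n (b : ℕ → Bool) → (∀ i j → i < n → j < n → T (b i) → T (b j) → i ≡ j) →
  Σ< n (λ i → 𝟙 (b i)) ≤ 1
Σ<-𝟙-unique zero    b unique = z≤n
Σ<-𝟙-unique (suc n) b unique with b 0 in b0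
... | false = Σ<-𝟙-unique n (λ i → b (suc i))
                (λ i j i<n j<n bi bj → suc-injective (unique (suc i) (suc j) (s≤s i<n) (s≤s j<n) bi bj))
... | true  = ≤-reflexive (cong suc (Σ<-zero n _ tail-false))
  where
  tail-false : ∀ i → i < n → 𝟙 (b (suc i)) ≡ 0
  tail-false i i<n with b (suc i) in bi
  ... | false = refl
  ... | true  = contradiction (unique 0 (suc i) z<s (s≤s i<n) (subst T (sym b0) tt) (subst T (sym bi) tt))
                  (λ ())

Σ<-⊓ : ∀ n u f → Σ< (u ⊓ n) f ≡ Σ< n (λ j → 𝟙 (j <ᵇ u) * f j)
Σ<-⊓ zero    zero    f = refl
Σ<-⊓ zero    (suc u) f = refl
Σ<-⊓ (suc n) zero    f = sym (Σ<-zero (suc n) _ (λ _ _ → refl))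
Σ<-⊓ (suc n) (suc u) f = cong₂ _+_ (sym (+-identityʳ (f 0))) (Σ<-⊓ n u (λ j → f (suc j)))

Σ<-telescope : ∀ (G D : ℕ → ℕ) n → (∀ j → j < n → G (suc j) ≡ G j + D j) → ∀ m → m ≤ n → G m ≡ G 0 + Σ< m D
Σ<-telescope G D n step zero    _   = sym (+-identityʳ (G 0))
Σ<-telescope G D n step (suc m) m<n = begin
  G (suc m)               ≡⟨ step m m<n ⟩
  G m + D m               ≡⟨ cong (_+ D m) (Σ<-telescope G D n step m (<⇒≤ m<n)) ⟩
  G 0 + Σ< m D + D m      ≡⟨ +-assoc (G 0) _ (D m) ⟩
  G 0 + (Σ< m D + D m)    ≡⟨ cong (G 0 +_) (sym (Σ<-snoc m D)) ⟩
  G 0 + Σ< (suc m) D      ∎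
  where open ≡-Reasoning

Σ<-weighted-⊓ : ∀ H a (m : ℕ → ℕ) → a ≤ H →
  Σ< H (λ j → (a ⊓ suc j) * m (suc j)) ≡ Σ< a (λ i → suc i * m (suc i)) + a * Σ< (H ∸ a) (λ i → m (suc (a + i)))
Σ<-weighted-⊓ H a m a≤H = begin
  Σ< H (λ j → (a ⊓ suc j) * m (suc j))
    ≡⟨ cong (λ n → Σ< n (λ j → (a ⊓ suc j) * m (suc j))) (sym (m+[n∸m]≡n a≤H)) ⟩
  Σ< (a + (H ∸ a)) (λ j → (a ⊓ suc j) * m (suc j))
    ≡⟨ Σ<-split a (H ∸ a) _ ⟩
  Σ< a (λ j → (a ⊓ suc j) * m (suc j)) + Σ< (H ∸ a) (λ i → (a ⊓ suc (a + i)) * m (suc (a + i)))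
    ≡⟨ cong₂ _+_ (Σ<-cong-< a (λ i i<a → cong (_* m (suc i)) (m≥n⇒m⊓n≡n i<a)))
                 (Σ<-cong (H ∸ a) (λ i → cong (_* m (suc (a + i))) (m≤n⇒m⊓n≡m (m≤n⇒m≤1+n (m≤m+n a i))))) ⟩
  Σ< a (λ i → suc i * m (suc i)) + Σ< (H ∸ a) (λ i → a * m (suc (a + i)))
    ≡⟨ cong (Σ< a (λ i → suc i * m (suc i)) +_) (Σ<-*ˡ (H ∸ a) a (λ i → m (suc (a + i)))) ⟩
  Σ< a (λ i → suc i * m (suc i)) + a * Σ< (H ∸ a) (λ i → m (suc (a + i))) ∎
  where open ≡-Reasoning

Π<-ones : ∀ n f → (∀ i → f i ≡ 1) → Π< n f ≡ 1
Π<-ones zero    f eq = refl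
Π<-ones (suc n) f eq = cong₂ _*_ (eq 0) (Π<-ones n (λ i → f (suc i)) (λ i → eq (suc i)))

Π<-^ : ∀ n (f : ℕ → ℕ) w → Π< n f ^ w ≡ Π< n (λ i → f i ^ w)
Π<-^ zero    f w = ^-zeroˡ w
Π<-^ (suc n) f w = trans (^-distribʳ-* (f 0) _ w) (cong (f 0 ^ w *_) (Π<-^ n (λ i → f (suc i)) w))

Π<-distrib-* : ∀ n (f g : ℕ → ℕ) → Π< n (λ i → f i * g i) ≡ Π< n f * Π< n g
Π<-distrib-* zero    f g = refl
Π<-distrib-* (suc n) f g = trans (cong (f 0 * g 0 *_) (Π<-distrib-* n (λ i → f (suc i)) (λ i → g (suc i))))
  (*-interchange (f 0) (g 0) _ _)

Π<-^-Σ< : ∀ p n (a : ℕ → ℕ) → Π< n (λ i → p ^ a i) ≡ p ^ Σ< n a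
Π<-^-Σ< p zero    a = refl
Π<-^-Σ< p (suc n) a = trans (cong (p ^ a 0 *_) (Π<-^-Σ< p n (λ i → a (suc i)))) (sym (^-distribˡ-+-* p (a 0) _))

Π<-δ : ∀ n a (f : ℕ → ℕ) → a < n → Π< n (λ i → f i ^ δ a i) ≡ f a
Π<-δ (suc n) zero    f _         = trans (cong₂ _*_ (*-identityʳ (f 0)) (Π<-ones n _ (λ i → refl))) (*-identityʳ (f 0))
Π<-δ (suc n) (suc a) f (s≤s a<n) = trans (+-identityʳ _) (Π<-δ n a (λ i → f (suc i)) a<n)

sum-applyUpTo : ∀ n (g f : ℕ → ℕ) → sumℕ (map g (applyUpTo f n)) ≡ Σ< n (λ i → g (f i))
sum-applyUpTo zero    g f = refl
sum-applyUpTo (suc n) g f = cong (g (f 0) +_) (sum-applyUpTo n g (λ i → f (suc i)))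

prod-applyUpTo : ∀ n (g f : ℕ → ℕ) → prodℕ (map g (applyUpTo f n)) ≡ Π< n (λ i → g (f i))
prod-applyUpTo zero    g f = refl
prod-applyUpTo (suc n) g f = cong (g (f 0) *_) (prod-applyUpTo n g (λ i → f (suc i)))

sum-range : ∀ a b (g : ℕ → ℕ) → sumℕ (map g (range a b)) ≡ Σ< (suc b ∸ a) (λ i → g (a + i))
sum-range a b g = sum-applyUpTo (suc b ∸ a) g (a +_)

prod-range : ∀ a b (g : ℕ → ℕ) → prodℕ (map g (range a b)) ≡ Π< (suc b ∸ a) (λ i → g (a + i))
prod-range a b g = prod-applyUpTo (suc b ∸ a) g (a +_)

sum-*ˡ : ∀ {A : Set} c (f : A → ℕ) xs → sumℕ (map (λ x → c * f x) xs) ≡ c * sumℕ (map f xs)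
sum-*ˡ c f []       = sym (*-zeroʳ c)
sum-*ˡ c f (x ∷ xs) = trans (cong (c * f x +_) (sum-*ˡ c f xs)) (sym (*-distribˡ-+ c (f x) _))

sum-Σ< : ∀ {A : Set} M (f : A → ℕ → ℕ) xs →
  sumℕ (map (λ x → Σ< M (f x)) xs) ≡ Σ< M (λ t → sumℕ (map (λ x → f x t) xs))
sum-Σ< M f []       = sym (Σ<-zero M _ (λ _ _ → refl))
sum-Σ< M f (x ∷ xs) = trans (cong (Σ< M (f x) +_) (sum-Σ< M f xs)) (sym (Σ<-distrib-+ M (f x) _))

sum-concatMap : ∀ {A B : Set} (h : B → ℕ) (g : A → List B) xs →
  sumℕ (map h (concatMap g xs)) ≡ sumℕ (map (λ x → sumℕ (map h (g x))) xs)
sum-concatMap h g []       = refl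
sum-concatMap h g (x ∷ xs) = trans (cong sumℕ (map-++ h (g x) (concatMap g xs)))
  (trans (sum-++ (map h (g x)) _) (cong (sumℕ (map h (g x)) +_) (sum-concatMap h g xs)))

prod-concatMap : ∀ {A B : Set} (h : B → ℕ) (g : A → List B) xs →
  prodℕ (map h (concatMap g xs)) ≡ prodℕ (map (λ x → prodℕ (map h (g x))) xs)
prod-concatMap h g []       = refl
prod-concatMap h g (x ∷ xs) = trans (cong prodℕ (map-++ h (g x) (concatMap g xs)))
  (trans (product-++ (map h (g x)) _) (cong (prodℕ (map h (g x)) *_) (prod-concatMap h g xs)))

prod-replicate : ∀ (h : ℕ → ℕ) c a → prodℕ (map h (replicate c a)) ≡ h a ^ c
prod-replicate h zero    a = refl
prod-replicate h (suc c) a = cong (h a *_) (prod-replicate h c a)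

prod-ones : ∀ {A : Set} (xs : List A) → prodℕ (map (λ _ → 1) xs) ≡ 1
prod-ones []       = refl
prod-ones (x ∷ xs) = trans (+-identityʳ _) (prod-ones xs)

prod-distrib-* : ∀ {A : Set} (f g : A → ℕ) xs → prodℕ (map (λ x → f x * g x) xs) ≡ prodℕ (map f xs) * prodℕ (map g xs)
prod-distrib-* f g []       = refl
prod-distrib-* f g (x ∷ xs) = trans (cong (f x * g x *_) (prod-distrib-* f g xs)) (*-interchange (f x) (g x) _ _)

prod-^ : ∀ {A : Set} (f : A → ℕ) xs w → prodℕ (map f xs) ^ w ≡ prodℕ (map (λ x → f x ^ w) xs)
prod-^ f []       w = ^-zeroˡ w
prod-^ f (x ∷ xs) w = trans (^-distribʳ-* (f x) _ w) (cong (f x ^ w *_) (prod-^ f xs w))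

prod-swap : ∀ {A B : Set} (g : A → B → ℕ) xs ys →
  prodℕ (map (λ x → prodℕ (map (g x) ys)) xs) ≡ prodℕ (map (λ y → prodℕ (map (λ x → g x y) xs)) ys)
prod-swap g []       ys = sym (prod-ones ys)
prod-swap g (x ∷ xs) ys = trans (cong (prodℕ (map (g x) ys) *_) (prod-swap g xs ys))
  (sym (prod-distrib-* (g x) (λ y → prodℕ (map (λ x′ → g x′ y) xs)) ys))

length-filter-∷ : ∀ {A : Set} {P : A → Set} (P? : ∀ x → Dec (P x)) x xs →
  length (filter P? (x ∷ xs)) ≡ 𝟙 (does (P? x)) + length (filter P? xs)
length-filter-∷ P? x xs with P? x
... | yes _ = refl
... | no  _ = refl

prod-regroup : ∀ {A : Set} (e : A → ℕ) (x : ℕ → ℕ) → x 0 ≡ 1 → ∀ H xs → All (λ a → e a ≤ H) xs →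
  prodℕ (map (λ a → x (e a)) xs) ≡ Π< H (λ i → x (suc i) ^ length (filter (λ a → e a ≟ suc i) xs))
prod-regroup e x x0≡1 H []       []            = sym (Π<-ones H _ (λ _ → refl))
prod-regroup e x x0≡1 H (a ∷ xs) (eₐ≤H ∷ e≤H) = sym (begin
  Π< H (λ i → x (suc i) ^ length (filter (λ b → e b ≟ suc i) (a ∷ xs)))
    ≡⟨ Π<-cong-< H (λ i _ → cong (x (suc i) ^_) (length-filter-∷ (λ b → e b ≟ suc i) a xs)) ⟩
  Π< H (λ i → x (suc i) ^ (δ (e a) (suc i) + count i))
    ≡⟨ trans (Π<-cong-< H (λ i _ → ^-distribˡ-+-* (x (suc i)) (δ (e a) (suc i)) (count i))) (Π<-distrib-* H _ _) ⟩
  Π< H (λ i → x (suc i) ^ δ (e a) (suc i)) * Π< H (λ i → x (suc i) ^ count i)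
    ≡⟨ cong₂ _*_ (single (e a) eₐ≤H) (sym (prod-regroup e x x0≡1 H xs e≤H)) ⟩
  x (e a) * prodℕ (map (λ b → x (e b)) xs) ∎)
  where
  open ≡-Reasoning
  count : ℕ → ℕ
  count i = length (filter (λ b → e b ≟ suc i) xs)
  single : ∀ v → v ≤ H → Π< H (λ i → x (suc i) ^ δ v (suc i)) ≡ x v
  single zero    _   = trans (Π<-ones H _ (λ _ → refl)) (sym x0≡1)
  single (suc v) v<H = Π<-δ H v (λ i → x (suc i)) v<H

foldr-⊔-upper : ∀ xs → All (_≤ foldr _⊔_ 0 xs) xs
foldr-⊔-upper []       = []
foldr-⊔-upper (x ∷ xs) = m≤m⊔n x _ ∷ All.map (λ x≤ → ≤-trans x≤ (m≤n⊔m x _)) (foldr-⊔-upper xs)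

foldr-lcm-nonZero : ∀ xs → All NonZero xs → NonZero (foldr lcm 1 xs)
foldr-lcm-nonZero []       []           = _
foldr-lcm-nonZero (x ∷ xs) (x≢0 ∷ xs≢0) = ≢-nonZero (λ lcm≡0 → ≢-nonZero⁻¹ (x * y) {{m*n≢0 x y {{x≢0}} {{y≢0}}}}
  (trans (sym (gcd*lcm x y)) (trans (cong (gcd x y *_) lcm≡0) (*-zeroʳ (gcd x y)))))
  where
  y : ℕ
  y = foldr lcm 1 xs
  y≢0 : NonZero y
  y≢0 = foldr-lcm-nonZero xs xs≢0

foldr-lcm-∣ : ∀ xs → All (_∣ foldr lcm 1 xs) xs
foldr-lcm-∣ []       = []
foldr-lcm-∣ (x ∷ xs) = m∣lcm[m,n] x _ ∷ All.map (λ x∣ → ∣-trans x∣ (n∣lcm[m,n] x _)) (foldr-lcm-∣ xs)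

prime⇒≥2 : ∀ {p} → Prime p → 2 ≤ p
prime⇒≥2 {p} pp = nonTrivial⇒n>1 p {{prime⇒nonTrivial pp}}

prime⇒≥1 : ∀ {p} → Prime p → 1 ≤ p
prime⇒≥1 pp = ≤-trans (s≤s z≤n) (prime⇒≥2 pp)

prime∤⇒coprime : ∀ {p r} → Prime p → ¬ (p ∣ r) → Coprime p r
prime∤⇒coprime pp p∤r (i∣p , i∣r) with prime⇒irreducible pp i∣p
... | inj₁ i≡1 = i≡1
... | inj₂ i≡p = contradiction (subst (_∣ _) i≡p i∣r) p∤r

coprime-*ˡ : ∀ {x y m} → Coprime x m → Coprime y m → Coprime (x * y) m
coprime-*ˡ {x} cx cy {i} (i∣xy , i∣m) = cy (coprime-divisor cix i∣xy , i∣m)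
  where
  cix : Coprime i x
  cix (j∣i , j∣x) = cx (j∣x , ∣-trans j∣i i∣m)

coprime-^ˡ : ∀ {x m} a → Coprime x m → Coprime (x ^ a) m
coprime-^ˡ zero    c (i∣1 , _) = ∣1⇒≡1 i∣1
coprime-^ˡ (suc a) c           = coprime-*ˡ c (coprime-^ˡ a c)

prime∣^⇒∣ : ∀ {p q} e → Prime p → p ∣ q ^ e → p ∣ q
prime∣^⇒∣ zero    pp p∣1 = contradiction (∣1⇒≡1 p∣1) (>⇒≢ (prime⇒≥2 pp))
prime∣^⇒∣ {q = q} (suc e) pp p∣ with euclidsLemma q (q ^ e) pp p∣
... | inj₁ p∣q  = p∣q
... | inj₂ p∣qᵉ = prime∣^⇒∣ e pp p∣qᵉ

prime∣prime⇒≡ : ∀ {p q} → Prime p → Prime q → p ∣ q → p ≡ q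
prime∣prime⇒≡ pp pq p∣q with prime⇒irreducible pq p∣q
... | inj₁ p≡1 = contradiction p≡1 (>⇒≢ (prime⇒≥2 pp))
... | inj₂ p≡q = p≡q

prime∤^ : ∀ {p q} e → Prime p → Prime q → p ≢ q → ¬ (p ∣ q ^ e)
prime∤^ e pp pq p≢q p∣qᵉ = p≢q (prime∣prime⇒≡ pp pq (prime∣^⇒∣ e pp p∣qᵉ))


-- The p-adic valuation

ordAux-^-* : ∀ {p} → 2 ≤ p → ∀ e r f m → ¬ (p ∣ r) → m ≡ p ^ e * r → m ≤ f → ordAux f p m ≡ e
ordAux-^-* {p} p≥2 e r f zero p∤r m≡ m≤f with m*n≡0⇒m≡0∨n≡0 (p ^ e) (sym m≡)
... | inj₁ pᵉ≡0 = contradiction pᵉ≡0 (≢-nonZero⁻¹ _ {{m^n≢0 p e {{>-nonZero (≤-trans (s≤s z≤n) p≥2)}}}})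
... | inj₂ r≡0  = contradiction (subst (p ∣_) (sym r≡0) (p ∣0)) p∤r
ordAux-^-* (s≤s (s≤s z≤n)) e r zero (suc m) p∤r m≡ ()
ordAux-^-* {p@(suc (suc q))} (s≤s (s≤s z≤n)) zero r (suc f) (suc m) p∤r m≡ m≤f with suc m % p in rem
... | zero  = contradiction (subst (p ∣_) (trans m≡ (*-identityˡ r)) (m%n≡0⇒n∣m (suc m) p rem)) p∤r
... | suc _ = refl
ordAux-^-* {p@(suc (suc q))} p≥2@(s≤s (s≤s z≤n)) (suc e) r (suc f) (suc m) p∤r m≡ m≤f with suc m % p in rem
... | zero  = cong suc (ordAux-^-* p≥2 e r f (suc m / p) p∤r quotient≡ (≤-pred (≤-trans (m/n<m (suc m) p p≥2) m≤f)))
  where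
  quotient≡ : suc m / p ≡ p ^ e * r
  quotient≡ = trans (/-congˡ {o = p} (trans m≡ (trans (*-assoc p (p ^ e) r) (*-comm p (p ^ e * r))))) (m*n/n≡m (p ^ e * r) p)
... | suc _ = contradiction (trans (sym rem) (n∣m⇒m%n≡0 (suc m) p p∣m)) (λ ())
  where
  p∣m : p ∣ suc m
  p∣m = divides (p ^ e * r) (trans m≡ (trans (*-assoc p (p ^ e) r) (*-comm p (p ^ e * r))))

ord-^-* : ∀ {p} → 2 ≤ p → ∀ e r → ¬ (p ∣ r) → ord p (p ^ e * r) ≡ e
ord-^-* p≥2 e r p∤r = ordAux-^-* p≥2 e r _ _ p∤r refl ≤-refl

^-*-decomposition : ∀ {p} → 2 ≤ p → ∀ n → 1 ≤ n → ∃ λ e → ∃ λ r → n ≡ p ^ e * r × ¬ (p ∣ r)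
^-*-decomposition {p} p≥2 = <-rec _ step
  where
  step : ∀ n → (∀ {m} → m < n → 1 ≤ m → ∃ λ e → ∃ λ r → m ≡ p ^ e * r × ¬ (p ∣ r)) →
         1 ≤ n → ∃ λ e → ∃ λ r → n ≡ p ^ e * r × ¬ (p ∣ r)
  step n rec n≥1 with p ∣? n
  ... | no p∤n = 0 , n , sym (*-identityˡ n) , p∤n
  ... | yes (divides k n≡kp) with rec k<n k≥1
    where
    k≥1 : 1 ≤ k
    k≥1 = n≢0⇒n>0 (λ k≡0 → <⇒≢ n≥1 (sym (trans n≡kp (cong (_* p) k≡0))))
    k<n : k < n
    k<n = subst (k <_) (sym n≡kp) (m<m*n k p {{>-nonZero k≥1}} p≥2)
  ... | e , r , k≡ , p∤r = suc e , r , n≡ , p∤r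
    where
    n≡ : n ≡ p ^ suc e * r
    n≡ = trans n≡kp (trans (cong (_* p) k≡) (trans (*-comm (p ^ e * r) p) (sym (*-assoc p (p ^ e) r))))

ord-spec : ∀ {p} → 2 ≤ p → ∀ n → 1 ≤ n → ∃ λ r → n ≡ p ^ ord p n * r × ¬ (p ∣ r)
ord-spec {p} p≥2 n n≥1 with ^-*-decomposition p≥2 n n≥1
... | e , r , n≡ , p∤r = r , trans n≡ (cong (λ x → p ^ x * r) (sym ord≡e)) , p∤r
  where
  ord≡e : ord p n ≡ e
  ord≡e = trans (cong (ord p) n≡) (ord-^-* p≥2 e r p∤r)

ord-other-prime : ∀ {p q} → Prime p → Prime q → p ≢ q → ∀ e r → 1 ≤ r → ord q (p ^ e * r) ≡ ord q r
ord-other-prime {p} {q} pp pq p≢q e r r≥1 with ord-spec (prime⇒≥2 pq) r r≥1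
... | s , r≡ , q∤s = trans (cong (ord q) regroup) (ord-^-* (prime⇒≥2 pq) (ord q r) (p ^ e * s) q∤pᵉs)
  where
  regroup : p ^ e * r ≡ q ^ ord q r * (p ^ e * s)
  regroup = trans (cong (p ^ e *_) r≡) (trans (sym (*-assoc (p ^ e) (q ^ ord q r) s))
            (trans (cong (_* s) (*-comm (p ^ e) (q ^ ord q r))) (*-assoc (q ^ ord q r) (p ^ e) s)))
  q∤pᵉs : ¬ (q ∣ p ^ e * s)
  q∤pᵉs q∣ with euclidsLemma (p ^ e) s pq q∣
  ... | inj₁ q∣pᵉ = prime∤^ e pq pp (λ q≡p → p≢q (sym q≡p)) q∣pᵉ
  ... | inj₂ q∣s  = q∤s q∣s

^∣⇒≤ord : ∀ {p} → 2 ≤ p → ∀ t l → 1 ≤ t → p ^ l ∣ t → l ≤ ord p t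
^∣⇒≤ord {p} p≥2 t l t≥1 pˡ∣t with ord-spec p≥2 t t≥1
... | r , t≡ , p∤r = ≮⇒≥ (λ v<l → p∤r (*-cancelˡ-∣ (p ^ v) {{m^n≢0 p v {{>-nonZero (≤-trans (s≤s z≤n) p≥2)}}}}
                         (subst₂ _∣_ (*-comm p (p ^ v)) t≡ (∣-trans (^-monoʳ-∣ p v<l) pˡ∣t))))
  where
  v : ℕ
  v = ord p t

≤ord⇒^∣ : ∀ {p} → 2 ≤ p → ∀ t l → 1 ≤ t → l ≤ ord p t → p ^ l ∣ t
≤ord⇒^∣ {p} p≥2 t l t≥1 l≤v with ord-spec p≥2 t t≥1
... | r , t≡ , _ = subst (p ^ l ∣_) (sym t≡) (∣m⇒∣m*n r (^-monoʳ-∣ p l≤v))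

gcd-periodic : ∀ {m A} → m ∣ A → Periodic A (λ x → gcd x m)
gcd-periodic {m} {A} m∣A x = ∣-antisym
  (gcd-greatest (∣m+n∣m⇒∣n (subst (gcd (x + A) m ∣_) (+-comm x A) (gcd[m,n]∣m (x + A) m)) (∣-trans (gcd[m,n]∣n (x + A) m) m∣A))
                (gcd[m,n]∣n (x + A) m))
  (gcd-greatest (∣m∣n⇒∣m+n (gcd[m,n]∣m x m) (∣-trans (gcd[m,n]∣n x m) m∣A)) (gcd[m,n]∣n x m))

m∣n⇒gcd[m,n]≡m : ∀ {m n} → m ∣ n → gcd m n ≡ m
m∣n⇒gcd[m,n]≡m {m} {n} m∣n = ∣-antisym (gcd[m,n]∣m m n) (gcd-greatest ∣-refl m∣n)

n∣m⇒gcd[m,n]≡n : ∀ {m n} → n ∣ m → gcd m n ≡ n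
n∣m⇒gcd[m,n]≡n {m} {n} n∣m = ∣-antisym (gcd[m,n]∣n m n) (gcd-greatest n∣m ∣-refl)

coprime-∣-∣ : ∀ {m n m′ n′} → m′ ∣ m → n′ ∣ n → Coprime m n → Coprime m′ n′
coprime-∣-∣ m′∣m n′∣n c (i∣m′ , i∣n′) = c (∣-trans i∣m′ m′∣m , ∣-trans i∣n′ n′∣n)

coprime-*-∣ : ∀ {m n x} → Coprime m n → m ∣ x → n ∣ x → m * n ∣ x
coprime-*-∣ {m} {n} c (divides q x≡qm) n∣x with coprime-divisor (coprime-sym c) (subst (n ∣_) (trans x≡qm (*-comm q m)) n∣x)
... | n∣q = subst (m * n ∣_) (trans (*-comm m q) (sym x≡qm)) (*-monoʳ-∣ m n∣q)

-- gcd(l, ab) divides both l·gcd(l, b) and a·gcd(l, b), whose gcd is gcd(l, a)·gcd(l, b).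
gcd-*-∣ : ∀ l a b → gcd l (a * b) ∣ gcd l a * gcd l b
gcd-*-∣ l a b = subst (g ∣_) (trans (sym (c*gcd[m,n]≡gcd[cm,cn] g₂ l a)) (*-comm g₂ g₁))
  (gcd-greatest (subst (g ∣_) (*-comm l g₂) g∣lg₂) (subst (g ∣_) (*-comm a g₂) g∣ag₂))
  where
  g g₁ g₂ : ℕ
  g = gcd l (a * b)
  g₁ = gcd l a
  g₂ = gcd l b
  g∣l : g ∣ l
  g∣l = gcd[m,n]∣m l (a * b)
  g∣lg₂ : g ∣ l * g₂
  g∣lg₂ = subst (g ∣_) (sym (c*gcd[m,n]≡gcd[cm,cn] l l b)) (gcd-greatest (∣m⇒∣m*n l g∣l) (∣m⇒∣m*n b g∣l))
  g∣ag₂ : g ∣ a * g₂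
  g∣ag₂ = subst (g ∣_) (sym (c*gcd[m,n]≡gcd[cm,cn] a l b)) (gcd-greatest (∣n⇒∣m*n a g∣l) (gcd[m,n]∣n l (a * b)))

gcd-*-coprime : ∀ l a b → Coprime a b → gcd l (a * b) ≡ gcd l a * gcd l b
gcd-*-coprime l a b c = ∣-antisym (gcd-*-∣ l a b) (gcd-greatest
  (coprime-*-∣ c′ (gcd[m,n]∣m l a) (gcd[m,n]∣m l b))
  (*-pres-∣ (gcd[m,n]∣n l a) (gcd[m,n]∣n l b)))
  where
  c′ : Coprime (gcd l a) (gcd l b)
  c′ = coprime-∣-∣ (gcd[m,n]∣n l a) (gcd[m,n]∣n l b) c

gcd-^-^ : ∀ p a b → gcd (p ^ a) (p ^ b) ≡ p ^ (a ⊓ b)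
gcd-^-^ p a b with ≤-total a b
... | inj₁ a≤b = trans (m∣n⇒gcd[m,n]≡m (^-monoʳ-∣ p a≤b)) (cong (p ^_) (sym (m≤n⇒m⊓n≡m a≤b)))
... | inj₂ b≤a = trans (n∣m⇒gcd[m,n]≡n (^-monoʳ-∣ p b≤a)) (cong (p ^_) (sym (m≥n⇒m⊓n≡n b≤a)))

gcd-^ : ∀ {p} → Prime p → ∀ t i → 1 ≤ t → gcd t (p ^ i) ≡ p ^ (ord p t ⊓ i)
gcd-^ {p} pp t i t≥1 with ord-spec (prime⇒≥2 pp) t t≥1
... | r , t≡ , p∤r = begin
  gcd t (p ^ i)                          ≡⟨ trans (cong (λ x → gcd x (p ^ i)) t≡) (gcd-comm _ (p ^ i)) ⟩
  gcd (p ^ i) (p ^ v * r)                ≡⟨ gcd-*-coprime (p ^ i) (p ^ v) r (coprime-^ˡ v (prime∤⇒coprime pp p∤r)) ⟩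
  gcd (p ^ i) (p ^ v) * gcd (p ^ i) r    ≡⟨ cong₂ _*_ (gcd-^-^ p i v) (coprime⇒gcd≡1 (coprime-^ˡ i (prime∤⇒coprime pp p∤r))) ⟩
  p ^ (i ⊓ v) * 1                        ≡⟨ trans (*-identityʳ _) (cong (p ^_) (⊓-comm i v)) ⟩
  p ^ (v ⊓ i)                            ∎
  where
  open ≡-Reasoning
  v : ℕ
  v = ord p t

no-prime-divisor⇒≡1 : ∀ n → 1 ≤ n → (∀ q → Prime q → ¬ (q ∣ n)) → n ≡ 1
no-prime-divisor⇒≡1 n n≥1 none with factorise n {{>-nonZero n≥1}}
... | record { factors = []     ; isFactorisation = n≡1 } = n≡1
... | record { factors = q ∷ qs ; isFactorisation = n≡ ; factorsPrime = pq ∷ _ } =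
  contradiction (divides (product qs) (trans n≡ (*-comm q (product qs)))) (none q pq)

gcd-prime-factorisation : ∀ {P} → All Prime P → Unique P → ∀ l n → 1 ≤ n → (∀ q → Prime q → q ∣ n → q ∈ P) →
  gcd l n ≡ prodℕ (map (λ p → gcd l (p ^ ord p n)) P)
gcd-prime-factorisation [] [] l n n≥1 primes∈ =
  trans (cong (gcd l) (no-prime-divisor⇒≡1 n n≥1 (λ q pq q∣n → ∉[] (primes∈ q pq q∣n)))) (gcd-zeroʳ l)
  where
  ∉[] : ∀ {q} → ¬ (q ∈ [])
  ∉[] ()
gcd-prime-factorisation {p ∷ P} (pp ∷ primes) (p≢ ∷ unique) l n n≥1 primes∈ with ord-spec (prime⇒≥2 pp) n n≥1
... | r , n≡ , p∤r = begin
  gcd l n                                                ≡⟨ cong (gcd l) n≡ ⟩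
  gcd l (p ^ e * r)                                      ≡⟨ gcd-*-coprime l (p ^ e) r (coprime-^ˡ e (prime∤⇒coprime pp p∤r)) ⟩
  gcd l (p ^ e) * gcd l r                                ≡⟨ cong (gcd l (p ^ e) *_) (gcd-prime-factorisation primes unique l r r≥1 primes∈r) ⟩
  gcd l (p ^ e) * prodℕ (map (λ q → gcd l (q ^ ord q r)) P) ≡⟨ cong (λ xs → gcd l (p ^ e) * prodℕ xs) (map-cong-local same-ord) ⟩
  gcd l (p ^ e) * prodℕ (map (λ q → gcd l (q ^ ord q n)) P) ∎
  where
  open ≡-Reasoning
  e : ℕ
  e = ord p n
  r≥1 : 1 ≤ r
  r≥1 = n≢0⇒n>0 (λ r≡0 → <⇒≢ n≥1 (sym (trans n≡ (trans (cong (p ^ e *_) r≡0) (*-zeroʳ (p ^ e))))))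
  primes∈r : ∀ q → Prime q → q ∣ r → q ∈ P
  primes∈r q pq q∣r with primes∈ q pq (subst (q ∣_) (sym n≡) (∣n⇒∣m*n (p ^ e) q∣r))
  ... | here q≡p  = contradiction (subst (_∣ r) q≡p q∣r) p∤r
  ... | there q∈P = q∈P
  same-ord : All (λ q → gcd l (q ^ ord q r) ≡ gcd l (q ^ ord q n)) P
  same-ord = All.zipWith (λ {q} (pq , p≢q) → cong (λ x → gcd l (q ^ x))
    (sym (trans (cong (ord q) n≡) (ord-other-prime pp pq p≢q e r r≥1)))) (primes , p≢)

-- Sums of products of periodic functions (Chinese remainder theorem)

periodic-* : ∀ {A f} → Periodic A f → ∀ c x → f (x + c * A) ≡ f x
periodic-* {f = f} per zero    x = cong f (+-identityʳ x)
periodic-* {A} {f} per (suc c) x = begin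
  f (x + (A + c * A))    ≡⟨ cong f (trans (cong (x +_) (+-comm A (c * A))) (sym (+-assoc x (c * A) A))) ⟩
  f (x + c * A + A)      ≡⟨ per (x + c * A) ⟩
  f (x + c * A)          ≡⟨ periodic-* per c x ⟩
  f x                    ∎
  where open ≡-Reasoning

periodic-∣ : ∀ {A B f} → Periodic A f → A ∣ B → Periodic B f
periodic-∣ {f = f} per (divides c B≡cA) x = trans (cong (λ y → f (x + y)) B≡cA) (periodic-* per c x)

periodic-% : ∀ {A f} .{{_ : NonZero A}} → Periodic A f → ∀ x → f x ≡ f (x % A)
periodic-% {A} {f} per x = trans (cong f (m≡m%n+[m/n]*n x A)) (periodic-* per (x / A) (x % A))

%≡%⇒∣∸ : ∀ x y n .{{_ : NonZero n}} → x % n ≡ y % n → n ∣ y ∸ x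
%≡%⇒∣∸ x y n eq = divides (y / n ∸ x / n) (begin
  y ∸ x                                       ≡⟨ cong₂ _∸_ (m≡m%n+[m/n]*n y n) (m≡m%n+[m/n]*n x n) ⟩
  (y % n + y / n * n) ∸ (x % n + x / n * n)   ≡⟨ cong (λ r → (y % n + y / n * n) ∸ (r + x / n * n)) eq ⟩
  (y % n + y / n * n) ∸ (y % n + x / n * n)   ≡⟨ [m+n]∸[m+o]≡n∸o (y % n) _ _ ⟩
  y / n * n ∸ x / n * n                       ≡⟨ sym (*-distribʳ-∸ n (y / n) (x / n)) ⟩
  (y / n ∸ x / n) * n                         ∎)
  where open ≡-Reasoning

crt-injective-≤ : ∀ A B .{{_ : NonZero A}} .{{_ : NonZero B}} → Coprime A B → ∀ {x y} → x ≤ y → y < A * B →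
  x % A ≡ y % A → x % B ≡ y % B → x ≡ y
crt-injective-≤ A B c {x} {y} x≤y y< eqA eqB = sym (trans (sym (m∸n+n≡m x≤y)) (cong (_+ x) y∸x≡0))
  where
  AB∣y∸x : A * B ∣ y ∸ x
  AB∣y∸x = coprime-*-∣ c (%≡%⇒∣∸ x y A eqA) (%≡%⇒∣∸ x y B eqB)
  y∸x≡0 : y ∸ x ≡ 0
  y∸x≡0 with y ∸ x in d | AB∣y∸x
  ... | zero  | _    = refl
  ... | suc _ | AB∣d = contradiction (∣⇒≤ AB∣d) (<⇒≱ (subst (_< A * B) d (≤-<-trans (m∸n≤m y x) y<)))

crt-injective : ∀ A B .{{_ : NonZero A}} .{{_ : NonZero B}} → Coprime A B → ∀ {x y} → x < A * B → y < A * B →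
  x % A ≡ y % A → x % B ≡ y % B → x ≡ y
crt-injective A B c {x} {y} x< y< eqA eqB with ≤-total x y
... | inj₁ x≤y = crt-injective-≤ A B c x≤y y< eqA eqB
... | inj₂ y≤x = sym (crt-injective-≤ A B c y≤x x< (sym eqA) (sym eqB))

module _ (A B : ℕ) .{{_ : NonZero A}} .{{_ : NonZero B}} (coprime : Coprime A B) where

  private
    hits : ℕ → ℕ → ℕ → Bool
    hits l a b = does (l % A ≟ a) ∧ does (l % B ≟ b)

    count : ℕ → ℕ → ℕ
    count a b = Σ< (A * B) (λ l → 𝟙 (hits l a b))

    count≤1 : ∀ a b → count a b ≤ 1
    count≤1 a b = Σ<-𝟙-unique (A * B) (λ l → hits l a b) (λ i j i< j< hitᵢ hitⱼ →
      let i%A , i%B = Equivalence.to Bool.T-∧ hitᵢ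
          j%A , j%B = Equivalence.to Bool.T-∧ hitⱼ
      in crt-injective A B coprime i< j<
           (trans (≡ᵇ⇒≡ _ a i%A) (sym (≡ᵇ⇒≡ _ a j%A))) (trans (≡ᵇ⇒≡ _ b i%B) (sym (≡ᵇ⇒≡ _ b j%B))))

    Σ<-count : Σ< A (λ a → Σ< B (count a)) ≡ A * B
    Σ<-count = begin
      Σ< A (λ a → Σ< B (count a))
        ≡⟨ Σ<-cong A (λ a → sym (Σ<-swap (A * B) B (λ l b → 𝟙 (hits l a b)))) ⟩
      Σ< A (λ a → Σ< (A * B) (λ l → Σ< B (λ b → 𝟙 (hits l a b))))
        ≡⟨ sym (Σ<-swap (A * B) A _) ⟩
      Σ< (A * B) (λ l → Σ< A (λ a → Σ< B (λ b → 𝟙 (hits l a b))))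
        ≡⟨ Σ<-cong (A * B) one-each ⟩
      Σ< (A * B) (λ _ → 1)
        ≡⟨ trans (Σ<-const (A * B) 1) (*-identityʳ (A * B)) ⟩
      A * B ∎
      where
      open ≡-Reasoning
      one-each : ∀ l → Σ< A (λ a → Σ< B (λ b → 𝟙 (hits l a b))) ≡ 1
      one-each l = begin
        Σ< A (λ a → Σ< B (λ b → 𝟙 (hits l a b)))           ≡⟨ Σ<-cong A (λ a → Σ<-cong B (λ b → 𝟙-∧ (does (l % A ≟ a)) _)) ⟩
        Σ< A (λ a → Σ< B (λ b → δ (l % A) a * δ (l % B) b)) ≡⟨ Σ<-cong A (λ a → Σ<-*ˡ B (δ (l % A) a) (δ (l % B))) ⟩
        Σ< A (λ a → δ (l % A) a * Σ< B (δ (l % B)))         ≡⟨ Σ<-*ʳ A _ (δ (l % A)) ⟩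
        Σ< A (δ (l % A)) * Σ< B (δ (l % B))                 ≡⟨ cong₂ _*_ (Σ<-δ-1 A (l % A) (m%n<n l A)) (Σ<-δ-1 B (l % B) (m%n<n l B)) ⟩
        1                                                   ∎

    -- Each of the A B pairs (a, b) is hit at most once by the A B values of l, hence exactly once.
    count≡1 : ∀ a b → a < A → b < B → count a b ≡ 1
    count≡1 a b a<A b<B = Σ<-≤-tight B 1 (count a) (λ b _ → count≤1 a b) (trans (row≡B a a<A) (sym (*-identityʳ B))) b b<B
      where
      row≤B : ∀ a → a < A → Σ< B (count a) ≤ B
      row≤B a _ = subst (Σ< B (count a) ≤_) (*-identityʳ B) (Σ<-≤ B 1 (count a) (λ b _ → count≤1 a b))
      row≡B : ∀ a → a < A → Σ< B (count a) ≡ B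
      row≡B = Σ<-≤-tight A B (λ a → Σ< B (count a)) row≤B Σ<-count

  Σ<-crt : ∀ f g → Periodic A f → Periodic B g → Σ< (A * B) (λ l → f l * g l) ≡ Σ< A f * Σ< B g
  Σ<-crt f g per-f per-g = begin
    Σ< (A * B) (λ l → f l * g l)
      ≡⟨ Σ<-cong (A * B) expand ⟩
    Σ< (A * B) (λ l → Σ< A (λ a → Σ< B (λ b → 𝟙 (hits l a b) * (f a * g b))))
      ≡⟨ trans (Σ<-swap (A * B) A _) (Σ<-cong A (λ a → Σ<-swap (A * B) B _)) ⟩
    Σ< A (λ a → Σ< B (λ b → Σ< (A * B) (λ l → 𝟙 (hits l a b) * (f a * g b))))
      ≡⟨ Σ<-cong A (λ a → Σ<-cong B (λ b → Σ<-*ʳ (A * B) (f a * g b) (λ l → 𝟙 (hits l a b)))) ⟩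
    Σ< A (λ a → Σ< B (λ b → count a b * (f a * g b)))
      ≡⟨ Σ<-cong-< A (λ a a< → Σ<-cong-< B (λ b b< → trans (cong (_* (f a * g b)) (count≡1 a b a< b<)) (*-identityˡ _))) ⟩
    Σ< A (λ a → Σ< B (λ b → f a * g b))
      ≡⟨ trans (Σ<-cong A (λ a → Σ<-*ˡ B (f a) g)) (Σ<-*ʳ A (Σ< B g) f) ⟩
    Σ< A f * Σ< B g ∎
    where
    open ≡-Reasoning
    expand : ∀ l → f l * g l ≡ Σ< A (λ a → Σ< B (λ b → 𝟙 (hits l a b) * (f a * g b)))
    expand l = begin
      f l * g l
        ≡⟨ cong₂ _*_ (trans (periodic-% per-f l) (sym (Σ<-δ A (l % A) f (m%n<n l A))))
                     (trans (periodic-% per-g l) (sym (Σ<-δ B (l % B) g (m%n<n l B)))) ⟩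
      Σ< A (λ a → δ (l % A) a * f a) * Σ< B (λ b → δ (l % B) b * g b)
        ≡⟨ sym (trans (Σ<-cong A (λ a → Σ<-*ˡ B (δ (l % A) a * f a) _)) (Σ<-*ʳ A _ _)) ⟩
      Σ< A (λ a → Σ< B (λ b → δ (l % A) a * f a * (δ (l % B) b * g b)))
        ≡⟨ Σ<-cong A (λ a → Σ<-cong B (λ b → trans (*-interchange (δ (l % A) a) (f a) (δ (l % B) b) (g b))
                                                   (cong (_* (f a * g b)) (sym (𝟙-∧ (does (l % A ≟ a)) _))))) ⟩
      Σ< A (λ a → Σ< B (λ b → 𝟙 (hits l a b) * (f a * g b))) ∎

coprime-product : ∀ {m} ys → All (Coprime m) ys → Coprime m (product ys)
coprime-product []       []         (_ , i∣1) = ∣1⇒≡1 i∣1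
coprime-product (y ∷ ys) (c ∷ cs)             = coprime-sym (coprime-*ˡ (coprime-sym c) (coprime-sym (coprime-product ys cs)))

periodic-product : ∀ {A : Set} {B} (F : A → ℕ → ℕ) xs → All (λ x → Periodic B (F x)) xs →
  Periodic B (λ l → prodℕ (map (λ x → F x l) xs))
periodic-product F []       []           l = refl
periodic-product F (x ∷ xs) (per ∷ pers) l = cong₂ _*_ (per l) (periodic-product F xs pers l)

periodic-product-∣ : ∀ {A : Set} (F : A → ℕ → ℕ) (period : A → ℕ) xs → All (λ x → Periodic (period x) (F x)) xs →
  Periodic (prodℕ (map period xs)) (λ l → prodℕ (map (λ x → F x l) xs))
periodic-product-∣ F period xs pers = periodic-product F xs (All.tabulate (λ {x} x∈xs →
  periodic-∣ (All.lookup pers x∈xs) (∈⇒∣product (∈-map⁺ period x∈xs))))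

periodic-product-gcd : ∀ {A} ms → All (_∣ A) ms → Periodic A (λ x → prodℕ (map (gcd x) ms))
periodic-product-gcd ms m∣A = periodic-product (λ m x → gcd x m) ms (All.map gcd-periodic m∣A)

prime-powers-nonZero : ∀ {P} (H : ℕ → ℕ) → All Prime P → All (λ p → NonZero (p ^ H p)) P
prime-powers-nonZero H = All.map (λ {p} pp → m^n≢0 p (H p) {{>-nonZero (prime⇒≥1 pp)}})

Σ<-crt-primes : ∀ {P} → All Prime P → Unique P → (H : ℕ → ℕ) (F : ℕ → ℕ → ℕ) → All (λ p → Periodic (p ^ H p) (F p)) P →
  Σ< (prodℕ (map (λ p → p ^ H p) P)) (λ l → prodℕ (map (λ p → F p l) P)) ≡ prodℕ (map (λ p → Σ< (p ^ H p) (F p)) P)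
Σ<-crt-primes [] [] H F [] = refl
Σ<-crt-primes {p ∷ P} (pp ∷ primes) (p≢ ∷ unique) H F (per ∷ pers) =
  trans (Σ<-crt A B {{m^n≢0 p (H p) {{>-nonZero (prime⇒≥1 pp)}}}} {{product≢0 (map⁺ (prime-powers-nonZero H primes))}}
           coprime (F p) (λ l → prodℕ (map (λ q → F q l) P)) per per-rest)
        (cong (Σ< A (F p) *_) (Σ<-crt-primes primes unique H F pers))
  where
  A B : ℕ
  A = p ^ H p
  B = prodℕ (map (λ q → q ^ H q) P)
  coprime : Coprime A B
  coprime = coprime-product (map (λ q → q ^ H q) P) (map⁺ (All.zipWith coprime-power (primes , p≢)))
    where
    coprime-power : ∀ {q} → Prime q × p ≢ q → Coprime A (q ^ H q)
    coprime-power {q} (pq , p≢q) = coprime-^ˡ (H p) (prime∤⇒coprime pp (prime∤^ (H q) pp pq p≢q))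
  per-rest : Periodic B (λ l → prodℕ (map (λ q → F q l) P))
  per-rest = periodic-product-∣ F (λ q → q ^ H q) P pers

Σ<-𝟙-∣-below-self : ∀ d → .{{NonZero d}} → Σ< d (λ x → 𝟙 (does (d ∣? x))) ≡ 1
Σ<-𝟙-∣-below-self (suc d) = cong₂ _+_ (cong 𝟙 (dec-true (suc d ∣? 0) (suc d ∣0))) (Σ<-zero d _ no-multiple)
  where
  no-multiple : ∀ i → i < d → 𝟙 (does (suc d ∣? suc i)) ≡ 0
  no-multiple i i<d = cong 𝟙 (dec-false (suc d ∣? suc i) (λ d∣ → <⇒≱ (s≤s i<d) (∣⇒≤ d∣)))

Σ<-𝟙-∣ : ∀ c d → .{{NonZero d}} → Σ< (c * d) (λ x → 𝟙 (does (d ∣? x))) ≡ c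
Σ<-𝟙-∣ c d = trans (Σ<-periodic d c _ periodic) (trans (cong (c *_) (Σ<-𝟙-∣-below-self d)) (*-identityʳ c))
  where
  periodic : Periodic d (λ x → 𝟙 (does (d ∣? x)))
  periodic x = cong 𝟙 (reflects-⇔ (proof (d ∣? (x + d))) (proof (d ∣? x))
    (λ d∣x+d → ∣m+n∣m⇒∣n (subst (d ∣_) (+-comm x d) d∣x+d) ∣-refl) (λ d∣x → ∣m∣n⇒∣m+n d∣x ∣-refl))

-- With g = gcd t m, m ∣ t x iff m / g ∣ x, and there are g multiples of m / g below m.
Σ<-𝟙-∣-* : ∀ m t → .{{NonZero m}} → Σ< m (λ x → 𝟙 (does (m ∣? t * x))) ≡ gcd t m
Σ<-𝟙-∣-* m t = begin
  Σ< m (λ x → 𝟙 (does (m ∣? t * x)))        ≡⟨ cong (λ n → Σ< n (λ x → 𝟙 (does (m ∣? t * x)))) (sym m≡gm′) ⟩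
  Σ< (g * m′) (λ x → 𝟙 (does (m ∣? t * x))) ≡⟨ Σ<-cong (g * m′) (λ x → cong 𝟙 (reflects-⇔ (proof (m ∣? t * x)) (proof (m′ ∣? x)) (⇒m′∣ x) (m′∣⇒ x))) ⟩
  Σ< (g * m′) (λ x → 𝟙 (does (m′ ∣? x)))    ≡⟨ Σ<-𝟙-∣ g m′ {{m′≢0}} ⟩
  g                                         ∎
  where
  open ≡-Reasoning
  g : ℕ
  g = gcd t m
  instance
    g≢0 : NonZero g
    g≢0 = ≢-nonZero (λ g≡0 → ≢-nonZero⁻¹ m (gcd[m,n]≡0⇒n≡0 t g≡0))
  m′ : ℕ
  m′ = m / g
  t′ : ℕ
  t′ = t / g
  m≡gm′ : g * m′ ≡ m
  m≡gm′ = m*[n/m]≡n (gcd[m,n]∣n t m)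
  t≡gt′ : g * t′ ≡ t
  t≡gt′ = m*[n/m]≡n (gcd[m,n]∣m t m)
  m′≢0 : NonZero m′
  m′≢0 = ≢-nonZero (λ m′≡0 → ≢-nonZero⁻¹ m (trans (sym m≡gm′) (trans (cong (g *_) m′≡0) (*-zeroʳ g))))
  tx≡ : ∀ x → t * x ≡ g * (t′ * x)
  tx≡ x = trans (cong (_* x) (sym t≡gt′)) (*-assoc g t′ x)
  ⇒m′∣ : ∀ x → m ∣ t * x → m′ ∣ x
  ⇒m′∣ x m∣tx = coprime-divisor (coprime-sym (coprime-/gcd t m)) (*-cancelˡ-∣ g (subst₂ _∣_ (sym m≡gm′) (tx≡ x) m∣tx))
  m′∣⇒ : ∀ x → m′ ∣ x → m ∣ t * x
  m′∣⇒ x m′∣x = subst₂ _∣_ m≡gm′ (sym (tx≡ x)) (*-monoʳ-∣ g (∣n⇒∣m*n t′ m′∣x))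

-- Orders of elements of ∏ ℤ/mℤ

Kills : ℕ → List ℕ → List ℕ → Set
Kills t []       _        = ⊤
Kills t (m ∷ ms) []       = ⊤
Kills t (m ∷ ms) (x ∷ xs) = m ∣ t * x × Kills t ms xs

killsᵇ-reflects : ∀ t ms x → Reflects (Kills t ms x) (killsᵇ t ms x)
killsᵇ-reflects t []       _        = ofʸ tt
killsᵇ-reflects t (m ∷ ms) []       = ofʸ tt
killsᵇ-reflects t (m ∷ ms) (x ∷ xs) = proof (m ∣? t * x) ×-reflects killsᵇ-reflects t ms xs

kills-*ˡ : ∀ c a ms x → Kills a ms x → Kills (c * a) ms x
kills-*ˡ c a []       _        _          = tt
kills-*ˡ c a (m ∷ ms) []       _          = tt
kills-*ˡ c a (m ∷ ms) (x ∷ xs) (m∣ax , k) = subst (m ∣_) (sym (*-assoc c a x)) (∣n⇒∣m*n c m∣ax) , kills-*ˡ c a ms xs k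

kills-+-cancelˡ : ∀ a b ms x → Kills (a + b) ms x → Kills a ms x → Kills b ms x
kills-+-cancelˡ a b []       _        _               _          = tt
kills-+-cancelˡ a b (m ∷ ms) []       _               _          = tt
kills-+-cancelˡ a b (m ∷ ms) (x ∷ xs) (m∣[a+b]x , k₁) (m∣ax , k₂) =
  ∣m+n∣m⇒∣n (subst (m ∣_) (*-distribʳ-+ x a b) m∣[a+b]x) m∣ax , kills-+-cancelˡ a b ms xs k₁ k₂

kills-common-multiple : ∀ M ms x → All (_∣ M) ms → Kills M ms x
kills-common-multiple M []       _        _            = tt
kills-common-multiple M (m ∷ ms) []       _            = tt
kills-common-multiple M (m ∷ ms) (x ∷ xs) (m∣M ∷ m∣Ms) = ∣m⇒∣m*n x m∣M , kills-common-multiple M ms xs m∣Ms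

module _ (ms x : List ℕ) where

  searchFrom-spec : ∀ s f t₀ → s ≤ t₀ → t₀ ≤ s + f → Kills t₀ ms x →
    Kills (searchFrom s f ms x) ms x × s ≤ searchFrom s f ms x × (∀ t → s ≤ t → t < searchFrom s f ms x → ¬ Kills t ms x)
  searchFrom-spec s zero t₀ s≤t₀ t₀≤s+0 k = subst (λ t → Kills t ms x) (sym s≡t₀) k , ≤-refl , (λ t s≤t t<s → contradiction s≤t (<⇒≱ t<s))
    where
    s≡t₀ : s ≡ t₀
    s≡t₀ = ≤-antisym s≤t₀ (subst (t₀ ≤_) (+-identityʳ s) t₀≤s+0)
  searchFrom-spec s (suc f) t₀ s≤t₀ t₀≤ k with killsᵇ s ms x | killsᵇ-reflects s ms x
  ... | true  | ofʸ kₛ = kₛ , ≤-refl , (λ t s≤t t<s → contradiction s≤t (<⇒≱ t<s))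
  ... | false | ofⁿ ¬kₛ with searchFrom-spec (suc s) f t₀ s<t₀ (subst (t₀ ≤_) (+-suc s f) t₀≤) k
    where
    s<t₀ : s < t₀
    s<t₀ with m≤n⇒m<n∨m≡n s≤t₀
    ... | inj₁ s<t₀ = s<t₀
    ... | inj₂ s≡t₀ = contradiction (subst (λ t → Kills t ms x) (sym s≡t₀) k) ¬kₛ
  ...   | kᵣ , s<r , minimal = kᵣ , ≤-trans (n≤1+n s) s<r , minimal′
    where
    minimal′ : ∀ t → s ≤ t → t < searchFrom (suc s) f ms x → ¬ Kills t ms x
    minimal′ t s≤t t<r with m≤n⇒m<n∨m≡n s≤t
    ... | inj₁ s<t  = minimal t s<t t<r
    ... | inj₂ refl = ¬kₛ

  module _ (ms≢0 : All NonZero ms) where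

    private
      spec : Kills (order ms x) ms x × 1 ≤ order ms x × (∀ t → 1 ≤ t → t < order ms x → ¬ Kills t ms x)
      spec = searchFrom-spec 1 (prodℕ ms) (prodℕ ms) (>-nonZero⁻¹ _ {{product≢0 ms≢0}}) (n≤1+n _)
               (kills-common-multiple (prodℕ ms) ms x (All.tabulate ∈⇒∣product))

    order-kills : Kills (order ms x) ms x
    order-kills = proj₁ spec

    order≥1 : 1 ≤ order ms x
    order≥1 = proj₁ (proj₂ spec)

    order-minimal : ∀ t → 1 ≤ t → t < order ms x → ¬ Kills t ms x
    order-minimal = proj₂ (proj₂ spec)

    kills⇒order∣ : ∀ t → Kills t ms x → order ms x ∣ t
    kills⇒order∣ t k = m%n≡0⇒n∣m t o r≡0
      where
      o : ℕ
      o = order ms x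
      instance
        o≢0 : NonZero o
        o≢0 = >-nonZero order≥1
      r : ℕ
      r = t % o
      kᵣ : Kills r ms x
      kᵣ = kills-+-cancelˡ (t / o * o) r ms x
             (subst (λ u → Kills u ms x) (trans (m≡m%n+[m/n]*n t o) (+-comm r _)) k)
             (kills-*ˡ (t / o) o ms x order-kills)
      r≡0 : r ≡ 0
      r≡0 with r in r≡
      ... | zero  = refl
      ... | suc _ = contradiction (subst (λ u → Kills u ms x) r≡ kᵣ) (order-minimal _ (s≤s z≤n) (subst (_< o) r≡ (m%n<n t o)))

    order∣⇒kills : ∀ t → order ms x ∣ t → Kills t ms x
    order∣⇒kills t (divides c t≡co) = subst (λ u → Kills u ms x) (sym t≡co) (kills-*ˡ c (order ms x) ms x order-kills)

    -- order ms x divides M, and the t < M with t · x = 0 are the M / order ms x multiples of it.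
    recipℕ-order : ∀ M → .{{NonZero M}} → All (_∣ M) ms → recipℕ (order ms x) ≡ ratio (Σ< M (λ t → 𝟙 (killsᵇ t ms x))) M
    recipℕ-order M m∣M with kills⇒order∣ M (kills-common-multiple M ms x m∣M)
    ... | divides c M≡co = sym (begin
      ratio (Σ< M (λ t → 𝟙 (killsᵇ t ms x))) M  ≡⟨ cong (λ n → ratio (Σ< n (λ t → 𝟙 (killsᵇ t ms x))) n) M≡co ⟩
      ratio (Σ< (c * o) (λ t → 𝟙 (killsᵇ t ms x))) (c * o)
        ≡⟨ cong (λ n → ratio n (c * o)) (Σ<-cong (c * o) kills≡order∣) ⟩
      ratio (Σ< (c * o) (λ t → 𝟙 (does (o ∣? t)))) (c * o)
        ≡⟨ cong (λ n → ratio n (c * o)) (trans (Σ<-𝟙-∣ c o) (sym (*-identityʳ c))) ⟩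
      ratio (c * 1) (c * o)                     ≡⟨ ratio-cancelˡ c o 1 ⟩
      recipℕ o ℚ.* ℚ.1ℚ                         ≡⟨ ℚP.*-identityʳ (recipℕ o) ⟩
      recipℕ o                                  ∎)
      where
      open ≡-Reasoning
      o : ℕ
      o = order ms x
      instance
        o≢0 : NonZero o
        o≢0 = >-nonZero order≥1
        c≢0 : NonZero c
        c≢0 = ≢-nonZero (λ c≡0 → ≢-nonZero⁻¹ M (trans M≡co (cong (_* o) c≡0)))
      kills≡order∣ : ∀ t → 𝟙 (killsᵇ t ms x) ≡ 𝟙 (does (o ∣? t))
      kills≡order∣ t = cong 𝟙 (reflects-⇔ (killsᵇ-reflects t ms x) (proof (o ∣? t)) (kills⇒order∣ t) (order∣⇒kills t))

-- Counting formula for μ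

sum-elems-kills : ∀ t ms → All NonZero ms → sumℕ (map (λ x → 𝟙 (killsᵇ t ms x)) (elems ms)) ≡ prodℕ (map (gcd t) ms)
sum-elems-kills t []       []             = refl
sum-elems-kills t (m ∷ ms) (m≢0 ∷ ms≢0) = begin
  sumℕ (map (λ y → 𝟙 (killsᵇ t (m ∷ ms) y)) (concatMap (λ x → map (x ∷_) (elems ms)) (upTo m)))
    ≡⟨ sum-concatMap _ (λ x → map (x ∷_) (elems ms)) (upTo m) ⟩
  sumℕ (map (λ x → sumℕ (map (λ y → 𝟙 (killsᵇ t (m ∷ ms) y)) (map (x ∷_) (elems ms)))) (upTo m))
    ≡⟨ cong sumℕ (map-cong first-coordinate (upTo m)) ⟩
  sumℕ (map (λ x → 𝟙 (does (m ∣? t * x)) * prodℕ (map (gcd t) ms)) (upTo m))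
    ≡⟨ trans (sum-applyUpTo m _ (λ x → x)) (Σ<-*ʳ m _ (λ x → 𝟙 (does (m ∣? t * x)))) ⟩
  Σ< m (λ x → 𝟙 (does (m ∣? t * x))) * prodℕ (map (gcd t) ms)
    ≡⟨ cong (_* prodℕ (map (gcd t) ms)) (Σ<-𝟙-∣-* m t {{m≢0}}) ⟩
  gcd t m * prodℕ (map (gcd t) ms) ∎
  where
  open ≡-Reasoning
  first-coordinate : ∀ x → sumℕ (map (λ y → 𝟙 (killsᵇ t (m ∷ ms) y)) (map (x ∷_) (elems ms)))
                         ≡ 𝟙 (does (m ∣? t * x)) * prodℕ (map (gcd t) ms)
  first-coordinate x = begin
    sumℕ (map (λ y → 𝟙 (killsᵇ t (m ∷ ms) y)) (map (x ∷_) (elems ms)))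
      ≡⟨ cong sumℕ (sym (map-∘ (elems ms))) ⟩
    sumℕ (map (λ y → 𝟙 (does (m ∣? t * x) ∧ killsᵇ t ms y)) (elems ms))
      ≡⟨ cong sumℕ (map-cong (λ y → 𝟙-∧ (does (m ∣? t * x)) (killsᵇ t ms y)) (elems ms)) ⟩
    sumℕ (map (λ y → 𝟙 (does (m ∣? t * x)) * 𝟙 (killsᵇ t ms y)) (elems ms))
      ≡⟨ sum-*ˡ (𝟙 (does (m ∣? t * x))) _ (elems ms) ⟩
    𝟙 (does (m ∣? t * x)) * sumℕ (map (λ y → 𝟙 (killsᵇ t ms y)) (elems ms))
      ≡⟨ cong (𝟙 (does (m ∣? t * x)) *_) (sum-elems-kills t ms ms≢0) ⟩
    𝟙 (does (m ∣? t * x)) * prodℕ (map (gcd t) ms) ∎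

μ≡ratio-Σ<-prod-gcd : ∀ ms M → .{{NonZero M}} → All NonZero ms → All (_∣ M) ms →
  μ ms ≡ ratio (Σ< M (λ t → prodℕ (map (gcd t) ms))) M
μ≡ratio-Σ<-prod-gcd ms M ms≢0 m∣M = begin
  sumℚ (map (λ x → recipℕ (order ms x)) (elems ms))
    ≡⟨ cong sumℚ (map-cong (λ x → recipℕ-order ms x ms≢0 M m∣M) (elems ms)) ⟩
  sumℚ (map (λ x → recipℕ M ℚ.* ℕ→ℚ (Σ< M (λ t → 𝟙 (killsᵇ t ms x)))) (elems ms))
    ≡⟨ sym (ratio-sum _ M (elems ms)) ⟩
  ratio (sumℕ (map (λ x → Σ< M (λ t → 𝟙 (killsᵇ t ms x))) (elems ms))) M
    ≡⟨ cong (λ n → ratio n M) (trans (sum-Σ< M (λ x t → 𝟙 (killsᵇ t ms x)) (elems ms))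
                                     (Σ<-cong M (λ t → sum-elems-kills t ms ms≢0))) ⟩
  ratio (Σ< M (λ t → prodℕ (map (gcd t) ms))) M ∎
  where open ≡-Reasoning

-- The local factor at a prime p

prod-gcd-localModuli : ∀ k n w p t →
  prodℕ (map (gcd t) (localModuli k n w p)) ≡ Π< (h k n p) (λ j → gcd t (p ^ suc j) ^ (w * mult k n p (suc j)))
prod-gcd-localModuli k n w p t = begin
  prodℕ (map (gcd t) (concatMap (λ i → replicate (w * m i) (p ^ i)) (range 1 H)))
    ≡⟨ prod-concatMap (gcd t) (λ i → replicate (w * m i) (p ^ i)) (range 1 H) ⟩
  prodℕ (map (λ i → prodℕ (map (gcd t) (replicate (w * m i) (p ^ i)))) (range 1 H))
    ≡⟨ cong prodℕ (map-cong (λ i → prod-replicate (gcd t) (w * m i) (p ^ i)) (range 1 H)) ⟩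
  prodℕ (map (λ i → gcd t (p ^ i) ^ (w * m i)) (range 1 H))
    ≡⟨ prod-range 1 H _ ⟩
  Π< H (λ j → gcd t (p ^ suc j) ^ (w * m (suc j))) ∎
  where
  open ≡-Reasoning
  H : ℕ
  H = h k n p
  m : ℕ → ℕ
  m = mult k n p

module LocalFactor (k : ℕ) (n : Fin k → ℕ) (w p : ℕ) (pp : Prime p) where

  instance
    p≢0 : NonZero p
    p≢0 = >-nonZero (prime⇒≥1 pp)

  H : ℕ
  H = h k n p
  m : ℕ → ℕ
  m = mult k n p
  moduli : List ℕ
  moduli = localModuli k n w p

  moduli-nonZero : All NonZero moduli
  moduli-nonZero = concat⁺ (map⁺ (applyUpTo⁺₂ _ H (λ i → replicate⁺ _ (m^n≢0 p (suc i)))))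

  moduli-∣ : All (_∣ p ^ H) moduli
  moduli-∣ = concat⁺ (map⁺ (applyUpTo⁺₁ _ H (λ i<H → replicate⁺ _ (^-monoʳ-∣ p i<H))))

  Φ : ℕ → ℕ
  Φ t = prodℕ (map (gcd t) moduli)

  Φ-periodic : Periodic (p ^ H) Φ
  Φ-periodic = periodic-product-gcd moduli moduli-∣

  weight : ℕ → ℕ
  weight v = Σ< H (λ j → (v ⊓ suc j) * m (suc j))

  Φ≡ : ∀ t → 1 ≤ t → Φ t ≡ p ^ (w * weight (ord p t))
  Φ≡ t t≥1 = begin
    Φ t
      ≡⟨ prod-gcd-localModuli k n w p t ⟩
    Π< H (λ j → gcd t (p ^ suc j) ^ (w * m (suc j)))
      ≡⟨ Π<-cong-< H (λ j _ → trans (cong (_^ (w * m (suc j))) (gcd-^ pp t (suc j) t≥1)) (^-*-assoc p (v ⊓ suc j) (w * m (suc j)))) ⟩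
    Π< H (λ j → p ^ ((v ⊓ suc j) * (w * m (suc j))))
      ≡⟨ Π<-^-Σ< p H _ ⟩
    p ^ Σ< H (λ j → (v ⊓ suc j) * (w * m (suc j)))
      ≡⟨ cong (p ^_) (trans (Σ<-cong H (λ j → x*[y*z]≡y*[x*z] (v ⊓ suc j) w (m (suc j)))) (Σ<-*ˡ H w _)) ⟩
    p ^ (w * weight v) ∎
    where
    open ≡-Reasoning
    v : ℕ
    v = ord p t

  A S : ℕ → ℕ
  A j = Σ< j (λ i → suc i * m (suc i))
  S j = Σ< (H ∸ j) (λ i → m (suc (j + i)))

  weight≡ : ∀ j → j ≤ H → weight j ≡ A j + j * S j
  weight≡ j = Σ<-weighted-⊓ H j m

  expo≡ : ∀ j → expo k n w p (suc j) ≡ w * (A j + j * S j)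
  expo≡ j = cong₂ (λ a t → w * (a + j * t)) (sum-range 1 j (λ i → i * m i)) (sum-range (suc j) H m)

  S-suc : ∀ j → j < H → S j ≡ m (suc j) + S (suc j)
  S-suc j j<H = trans (cong (λ r → Σ< r (λ i → m (suc (j + i)))) (+-∸-assoc 1 j<H))
    (cong₂ _+_ (cong (λ i → m (suc i)) (+-identityʳ j)) (Σ<-cong (H ∸ suc j) (λ i → cong (λ x → m (suc x)) (+-suc j i))))

  weight-suc : ∀ j → j < H → weight (suc j) ≡ weight j + S j
  weight-suc j j<H = begin
    weight (suc j)                                        ≡⟨ weight≡ (suc j) j<H ⟩
    A (suc j) + suc j * S (suc j)                         ≡⟨ cong (_+ suc j * S (suc j)) (Σ<-snoc j (λ i → suc i * m (suc i))) ⟩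
    A j + suc j * m (suc j) + suc j * S (suc j)           ≡⟨ regroup (A j) j (m (suc j)) (S (suc j)) ⟩
    A j + j * (m (suc j) + S (suc j)) + (m (suc j) + S (suc j)) ≡⟨ cong (λ t → A j + j * t + t) (sym (S-suc j j<H)) ⟩
    A j + j * S j + S j                                   ≡⟨ cong (_+ S j) (sym (weight≡ j (<⇒≤ j<H))) ⟩
    weight j + S j                                        ∎
    where
    open ≡-Reasoning
    open ℕSolver.+-*-Solver
    regroup : ∀ a j x t → a + suc j * x + suc j * t ≡ a + j * (x + t) + (x + t)
    regroup = solve 4 (λ a j x t → a :+ (con 1 :+ j) :* x :+ (con 1 :+ j) :* t := a :+ j :* (x :+ t) :+ (x :+ t)) refl

  weight-cap : ∀ v → weight (v ⊓ H) ≡ weight v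
  weight-cap v = Σ<-cong-< H (λ j j<H → cong (_* m (suc j)) (trans (⊓-assoc v H (suc j)) (cong (v ⊓_) (m≥n⇒m⊓n≡n j<H))))

  weight-0 : weight 0 ≡ 0
  weight-0 = Σ<-zero H _ (λ _ _ → refl)

  -- D l / p ^ l is the l-th summand of localFormula₁.
  D : ℕ → ℕ
  D l = p ^ expo k n w p l * (p ^ (w * tailSum k n p l) ∸ 1)

  G : ℕ → ℕ
  G v = p ^ (w * weight v)

  G-step : ∀ j → j < H → G (suc j) ≡ G j + D (suc j)
  G-step j j<H = begin
    p ^ (w * weight (suc j))                   ≡⟨ cong (λ x → p ^ (w * x)) (weight-suc j j<H) ⟩
    p ^ (w * (weight j + S j))                 ≡⟨ trans (cong (p ^_) (*-distribˡ-+ w (weight j) (S j))) (^-distribˡ-+-* p (w * weight j) (w * S j)) ⟩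
    G j * p ^ (w * S j)                        ≡⟨ cong (G j *_) (sym (m+[n∸m]≡n (m^n>0 p (w * S j)))) ⟩
    G j * (1 + (p ^ (w * S j) ∸ 1))            ≡⟨ trans (*-distribˡ-+ (G j) 1 _) (cong (_+ G j * (p ^ (w * S j) ∸ 1)) (*-identityʳ (G j))) ⟩
    G j + G j * (p ^ (w * S j) ∸ 1)            ≡⟨ cong₂ (λ e s → G j + p ^ e * (p ^ (w * s) ∸ 1)) exponent (sym (sum-range (suc j) H m)) ⟩
    G j + D (suc j)                            ∎
    where
    open ≡-Reasoning
    exponent : w * weight j ≡ expo k n w p (suc j)
    exponent = trans (cong (w *_) (weight≡ j (<⇒≤ j<H))) (sym (expo≡ j))

  Φ-suc : ∀ t → Φ (suc t) ≡ 1 + Σ< H (λ j → 𝟙 (j <ᵇ ord p (suc t)) * D (suc j))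
  Φ-suc t = begin
    Φ (suc t)                                   ≡⟨ Φ≡ (suc t) (s≤s z≤n) ⟩
    G v                                         ≡⟨ cong (λ x → p ^ (w * x)) (sym (weight-cap v)) ⟩
    G (v ⊓ H)                                   ≡⟨ Σ<-telescope G (λ j → D (suc j)) H G-step (v ⊓ H) (m⊓n≤n v H) ⟩
    G 0 + Σ< (v ⊓ H) (λ j → D (suc j))          ≡⟨ cong₂ _+_ G-0 (Σ<-⊓ H v (λ j → D (suc j))) ⟩
    1 + Σ< H (λ j → 𝟙 (j <ᵇ v) * D (suc j))     ∎
    where
    open ≡-Reasoning
    v : ℕ
    v = ord p (suc t)
    G-0 : G 0 ≡ 1
    G-0 = trans (cong (λ x → p ^ (w * x)) weight-0) (cong (p ^_) (*-zeroʳ w))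

  Σ<-divisible : ∀ j → j < H → Σ< (p ^ H) (λ t → 𝟙 (j <ᵇ ord p (suc t))) ≡ p ^ (H ∸ suc j)
  Σ<-divisible j j<H = begin
    Σ< (p ^ H) (λ t → 𝟙 (j <ᵇ ord p (suc t)))
      ≡⟨ Σ<-cong (p ^ H) (λ t → cong 𝟙 (reflects-⇔ (<ᵇ-reflects-< j (ord p (suc t))) (proof (p ^ suc j ∣? suc t))
           (≤ord⇒^∣ (prime⇒≥2 pp) (suc t) (suc j) (s≤s z≤n)) (^∣⇒≤ord (prime⇒≥2 pp) (suc t) (suc j) (s≤s z≤n)))) ⟩
    Σ< (p ^ H) (λ t → 𝟙 (does (p ^ suc j ∣? suc t)))
      ≡⟨ Σ<-rotate (p ^ H) (λ t → 𝟙 (does (p ^ suc j ∣? t)))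
           (cong 𝟙 (trans (dec-true (p ^ suc j ∣? 0) ((p ^ suc j) ∣0)) (sym (dec-true (p ^ suc j ∣? p ^ H) (^-monoʳ-∣ p j<H))))) ⟩
    Σ< (p ^ H) (λ t → 𝟙 (does (p ^ suc j ∣? t)))
      ≡⟨ cong (λ x → Σ< x (λ t → 𝟙 (does (p ^ suc j ∣? t)))) (trans (^-split p j<H) (*-comm (p ^ suc j) _)) ⟩
    Σ< (p ^ (H ∸ suc j) * p ^ suc j) (λ t → 𝟙 (does (p ^ suc j ∣? t)))
      ≡⟨ Σ<-𝟙-∣ (p ^ (H ∸ suc j)) (p ^ suc j) {{m^n≢0 p (suc j)}} ⟩
    p ^ (H ∸ suc j) ∎
    where open ≡-Reasoning

  -- Summing over t = 1, …, p ^ H avoids the junk value ord p 0 = 0.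
  Σ<-Φ : Σ< (p ^ H) Φ ≡ p ^ H + Σ< H (λ j → p ^ (H ∸ suc j) * D (suc j))
  Σ<-Φ = begin
    Σ< (p ^ H) Φ
      ≡⟨ sym (Σ<-rotate (p ^ H) Φ (sym (Φ-periodic 0))) ⟩
    Σ< (p ^ H) (λ t → Φ (suc t))
      ≡⟨ trans (Σ<-cong (p ^ H) Φ-suc) (Σ<-distrib-+ (p ^ H) (λ _ → 1) _) ⟩
    Σ< (p ^ H) (λ _ → 1) + Σ< (p ^ H) (λ t → Σ< H (λ j → 𝟙 (j <ᵇ ord p (suc t)) * D (suc j)))
      ≡⟨ cong₂ _+_ (trans (Σ<-const (p ^ H) 1) (*-identityʳ (p ^ H))) (Σ<-swap (p ^ H) H _) ⟩
    p ^ H + Σ< H (λ j → Σ< (p ^ H) (λ t → 𝟙 (j <ᵇ ord p (suc t)) * D (suc j)))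
      ≡⟨ cong (p ^ H +_) (Σ<-cong-< H (λ j j<H → trans (Σ<-*ʳ (p ^ H) (D (suc j)) _) (cong (_* D (suc j)) (Σ<-divisible j j<H)))) ⟩
    p ^ H + Σ< H (λ j → p ^ (H ∸ suc j) * D (suc j)) ∎
    where open ≡-Reasoning

  term : ℕ → ℚ.ℚ
  term l = (ℕ→ℚ (p ^ (w * tailSum k n p l)) ℚ.- ℚ.1ℚ) ℚ.* ℕ→ℚ (p ^ expo k n w p l) ℚ.* recipℕ (p ^ l)

  ratio-term : ∀ l → l ≤ H → ratio (p ^ (H ∸ l) * D l) (p ^ H) ≡ term l
  ratio-term l l≤H = begin
    ratio (p ^ (H ∸ l) * D l) (p ^ H)                ≡⟨ cong (ratio (p ^ (H ∸ l) * D l)) (trans (^-split p l≤H) (*-comm (p ^ l) _)) ⟩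
    ratio (p ^ (H ∸ l) * D l) (p ^ (H ∸ l) * p ^ l)  ≡⟨ ratio-cancelˡ (p ^ (H ∸ l)) (p ^ l) (D l) {{m^n≢0 p (H ∸ l)}} {{m^n≢0 p l}} ⟩
    recipℕ (p ^ l) ℚ.* ℕ→ℚ (pᴱ * (X ∸ 1))             ≡⟨ cong (recipℕ (p ^ l) ℚ.*_) (trans (ℕ→ℚ-* pᴱ (X ∸ 1)) (cong (ℕ→ℚ pᴱ ℚ.*_) (ℕ→ℚ-pred X (m^n>0 p (w * tailSum k n p l))))) ⟩
    recipℕ (p ^ l) ℚ.* (ℕ→ℚ pᴱ ℚ.* (ℕ→ℚ X ℚ.- ℚ.1ℚ)) ≡⟨ x*[y*z]≡[z*y]*x (recipℕ (p ^ l)) (ℕ→ℚ pᴱ) (ℕ→ℚ X ℚ.- ℚ.1ℚ) ⟩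
    term l                                           ∎
    where
    open ≡-Reasoning
    pᴱ : ℕ
    pᴱ = p ^ expo k n w p l
    X : ℕ
    X = p ^ (w * tailSum k n p l)

  μ≡ratio-Σ<-Φ : μ moduli ≡ ratio (Σ< (p ^ H) Φ) (p ^ H)
  μ≡ratio-Σ<-Φ = μ≡ratio-Σ<-prod-gcd moduli (p ^ H) {{m^n≢0 p H}} moduli-nonZero moduli-∣

  μ≡localFormula₁ : μ moduli ≡ localFormula₁ k n w p
  μ≡localFormula₁ = begin
    μ moduli
      ≡⟨ μ≡ratio-Σ<-Φ ⟩
    ratio (Σ< (p ^ H) Φ) (p ^ H)
      ≡⟨ cong (λ x → ratio x (p ^ H)) (trans Σ<-Φ (cong (p ^ H +_) (sym (sum-range 1 H (λ l → p ^ (H ∸ l) * D l))))) ⟩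
    ratio (p ^ H + sumℕ (map (λ l → p ^ (H ∸ l) * D l) (range 1 H))) (p ^ H)
      ≡⟨ trans (ratio-+ (p ^ H) _ (p ^ H)) (cong₂ ℚ._+_ (ratio-self (p ^ H) {{m^n≢0 p H}}) (ratio-sum _ (p ^ H) (range 1 H))) ⟩
    ℚ.1ℚ ℚ.+ sumℚ (map (λ l → ratio (p ^ (H ∸ l) * D l) (p ^ H)) (range 1 H))
      ≡⟨ cong (λ xs → ℚ.1ℚ ℚ.+ sumℚ xs) (map-cong-local (applyUpTo⁺₁ _ H (λ {i} i<H → ratio-term (suc i) i<H))) ⟩
    localFormula₁ k n w p ∎
    where open ≡-Reasoning

localFormula₁≡localFormula₂ : ∀ k n w p → .{{NonZero p}} → localFormula₁ k n w p ≡ localFormula₂ k n w p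
localFormula₁≡localFormula₂ k n w p = cong (λ xs → ℚ.1ℚ ℚ.+ sumℚ xs) (map-cong (λ l →
  trans (ℚP.*-assoc (ℕ→ℚ (p ^ (w * tailSum k n p l)) ℚ.- ℚ.1ℚ) (ℕ→ℚ (p ^ expo k n w p l)) (recipℕ (p ^ l)))
        (cong ((ℕ→ℚ (p ^ (w * tailSum k n p l)) ℚ.- ℚ.1ℚ) ℚ.*_) (ℕ→ℚ-^-*-recipℕ-^ p (expo k n w p l) l))) (range 1 (h k n p)))

module Average (k : ℕ) (n : Fin k → ℕ) (n≥1 : ∀ j → 1 ≤ n j) (w : ℕ) where

  L : ℕ
  L = lcmAll k n
  P : List ℕ
  P = primesUpToL k n
  J : List (Fin k)
  J = allFin k

  instance
    L≢0 : NonZero L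
    L≢0 = foldr-lcm-nonZero (map n J) (map⁺ (All.universal (λ j → >-nonZero (n≥1 j)) J))

  nⱼ∣L : All (λ j → n j ∣ L) J
  nⱼ∣L = map⁻ (foldr-lcm-∣ (map n J))

  P-prime : All Prime P
  P-prime = all-filter prime? (range 0 L)

  P-unique : Unique P
  P-unique = Uniqueₚ.filter⁺ prime? (Uniqueₚ.applyUpTo⁺₁ (0 +_) (suc L) (λ i<j _ → <⇒≢ i<j))

  prime∣nⱼ⇒∈P : ∀ j q → Prime q → q ∣ n j → q ∈ P
  prime∣nⱼ⇒∈P j q pq q∣nⱼ = ∈-filter⁺ prime? (∈-applyUpTo⁺ (0 +_) (s≤s (∣⇒≤ (∣-trans q∣nⱼ (All.lookup nⱼ∣L (∈-allFin j)))))) pq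

  F : ℕ → ℕ
  F l = prodℕ (map (λ j → gcd l (n j)) J) ^ w

  Φ : ℕ → ℕ → ℕ
  Φ p l = prodℕ (map (gcd l) (localModuli k n w p))

  prod-gcd-^-ord : ∀ p l → prodℕ (map (λ j → gcd l (p ^ ord p (n j))) J) ^ w ≡ Φ p l
  prod-gcd-^-ord p l = begin
    prodℕ (map (λ j → gcd l (p ^ ord p (n j))) J) ^ w
      ≡⟨ cong (_^ w) (prod-regroup (λ j → ord p (n j)) (λ i → gcd l (p ^ i)) (gcd-zeroʳ l) (h k n p) J
                       (map⁻ (foldr-⊔-upper (map (λ j → ord p (n j)) J)))) ⟩
    Π< (h k n p) (λ i → gcd l (p ^ suc i) ^ mult k n p (suc i)) ^ w
      ≡⟨ Π<-^ (h k n p) _ w ⟩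
    Π< (h k n p) (λ i → (gcd l (p ^ suc i) ^ mult k n p (suc i)) ^ w)
      ≡⟨ Π<-cong-< (h k n p) (λ i _ → trans (^-*-assoc (gcd l (p ^ suc i)) (mult k n p (suc i)) w)
                                            (cong (gcd l (p ^ suc i) ^_) (*-comm (mult k n p (suc i)) w))) ⟩
    Π< (h k n p) (λ i → gcd l (p ^ suc i) ^ (w * mult k n p (suc i)))
      ≡⟨ sym (prod-gcd-localModuli k n w p l) ⟩
    Φ p l ∎
    where open ≡-Reasoning

  F-factor : ∀ l → F l ≡ prodℕ (map (λ p → Φ p l) P)
  F-factor l = begin
    prodℕ (map (λ j → gcd l (n j)) J) ^ w
      ≡⟨ cong (λ xs → prodℕ xs ^ w) (map-cong (λ j → gcd-prime-factorisation P-prime P-unique l (n j) (n≥1 j) (prime∣nⱼ⇒∈P j)) J) ⟩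
    prodℕ (map (λ j → prodℕ (map (λ p → gcd l (p ^ ord p (n j))) P)) J) ^ w
      ≡⟨ cong (_^ w) (prod-swap (λ j p → gcd l (p ^ ord p (n j))) J P) ⟩
    prodℕ (map (λ p → prodℕ (map (λ j → gcd l (p ^ ord p (n j))) J)) P) ^ w
      ≡⟨ prod-^ (λ p → prodℕ (map (λ j → gcd l (p ^ ord p (n j))) J)) P w ⟩
    prodℕ (map (λ p → prodℕ (map (λ j → gcd l (p ^ ord p (n j))) J) ^ w) P)
      ≡⟨ cong prodℕ (map-cong (λ p → prod-gcd-^-ord p l) P) ⟩
    prodℕ (map (λ p → Φ p l) P) ∎
    where open ≡-Reasoning

  -- M is in fact L, but it suffices that F has both periods.
  M : ℕ
  M = prodℕ (map (λ p → p ^ h k n p) P)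

  instance
    M≢0 : NonZero M
    M≢0 = product≢0 (map⁺ (prime-powers-nonZero (h k n) P-prime))

  Φ-periodic : All (λ p → Periodic (p ^ h k n p) (Φ p)) P
  Φ-periodic = All.map (λ pp → LocalFactor.Φ-periodic k n w _ pp) P-prime

  F-periodic-L : Periodic L F
  F-periodic-L x = cong (_^ w) (periodic-product (λ j l → gcd l (n j)) J (All.map gcd-periodic nⱼ∣L) x)

  F-periodic-M : Periodic M F
  F-periodic-M x = trans (F-factor (x + M)) (trans (periodic-product-∣ Φ (λ p → p ^ h k n p) P Φ-periodic x) (sym (F-factor x)))

  average≡muProduct : average k n w ≡ muProduct k n w
  average≡muProduct = begin
    ratio (sumℕ (map F (range 1 L))) L
      ≡⟨ cong (λ x → ratio x L) (trans (sum-range 1 L F) (Σ<-rotate L F (sym (F-periodic-L 0)))) ⟩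
    ratio (Σ< L F) L
      ≡⟨ ratio-cross (Σ< L F) (Σ< M F) L M cross ⟩
    ratio (Σ< M F) M
      ≡⟨ cong (λ x → ratio x M) (trans (Σ<-cong M F-factor) (Σ<-crt-primes P-prime P-unique (h k n) Φ Φ-periodic)) ⟩
    ratio (prodℕ (map (λ p → Σ< (p ^ h k n p) (Φ p)) P)) M
      ≡⟨ prodℚ-ratio (λ p → Σ< (p ^ h k n p) (Φ p)) (λ p → p ^ h k n p) P (prime-powers-nonZero (h k n) P-prime) ⟩
    prodℚ (map (λ p → ratio (Σ< (p ^ h k n p) (Φ p)) (p ^ h k n p)) P)
      ≡⟨ cong prodℚ (map-cong-local (All.map (λ pp → sym (LocalFactor.μ≡ratio-Σ<-Φ k n w _ pp)) P-prime)) ⟩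
    muProduct k n w ∎
    where
    open ≡-Reasoning
    cross : M * Σ< L F ≡ L * Σ< M F
    cross = trans (sym (Σ<-periodic L M F F-periodic-L)) (trans (cong (λ x → Σ< x F) (*-comm M L)) (Σ<-periodic M L F F-periodic-M))

theorem1p7 : (k : ℕ) (n : Fin k → ℕ) → (∀ j → 1 ≤ n j) → (w : ℕ) → 1 ≤ w →
    (average k n w ≡ muProduct k n w)
      × (muProduct k n w ≡ formulaProduct₁ k n w)
      × (formulaProduct₁ k n w ≡ formulaProduct₂ k n w)
theorem1p7 k n n≥1 w _ =
    average≡muProduct
  , cong prodℚ (map-cong-local (All.map (λ pp → LocalFactor.μ≡localFormula₁ k n w _ pp) P-prime))
  , cong prodℚ (map-cong-local (All.map (λ pp → localFormula₁≡localFormula₂ k n w _ {{>-nonZero (prime⇒≥1 pp)}}) P-prime))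
  where open Average k n n≥1 w using (average≡muProduct; P-prime)
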